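{- Let $\mathbb{F}$ be a field with $\operatorname{char}(\mathbb{F})\neq 2$. Let $f$ be a polynomial computed by an arithmetic formula of depth $d$. Then for every constant $\alpha\in\mathbb{F}$, some matrix $F\in Q(\alpha f)+\mathcal{O}(\varepsilon)$ can be written as a product of at most $45\cdot 9^d$ primitive Q-matrices, and $F$ has error degree at most $12\cdot 25^d$.
   Context: Arithmetic formulas are fan-in 2 formulas with gates $+$ and $\times$ whose leaves are variables or constants in $\mathbb{F}$; a formula of depth 0 is a single variable or constant. $\varepsilon$ is a formal variable. For a polynomial $h$ over $\mathbb{F}(\varepsilon)$, $Q(h)=\begin{pmatrix} h & 1\\ 1 & 0\end{pmatrix}$. A parametrized affine linear form is an affine linear form in the variables $x_1,x_2,\ldots$ with coefficients in $\mathbb{F}(\varepsilon)$; a primitive Q-matrix is a matrix $Q(\ell)$ with $\ell$ a parametrized affine linear form. $\mathcal{O}(\varepsilon)$ denotes $\varepsilon\,\mathbb{F}[\varepsilon,x_1,x_2,\ldots]$, and for a $2\times 2$ matrix $M$, $M+\mathcal{O}(\varepsilon)$ is the set of matrices $M+E$ with all entries of $E$ in $\mathcal{O}(\varepsilon)$. The error degree of a matrix with entries in $\mathbb{F}[\varepsilon,x_1,x_2,\ldots]$ is the largest power of $\varepsilon$ occurring in its entries. -}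

module Defs where

open import Level using (Level; _⊔_)
open import Data.Nat using (ℕ; zero; suc) renaming (_⊔_ to max)
open import Data.Product using (Σ; ∃; _×_; _,_)
open import Data.List using (List; []; _∷_; foldr)
open import Relation.Nullary using (¬_)
open import Algebra.Bundles using (CommutativeRing)

record Field (c ℓ : Level) : Set (Level.suc (c ⊔ ℓ)) where
  field
    commRing : CommutativeRing c ℓ
  open CommutativeRing commRing public
  field
    1≉0      : ¬ (1# ≈ 0#)
    inverse  : ∀ x → ¬ (x ≈ 0#) → ∃ λ y → x * y ≈ 1#

CharNot2 : ∀ {c ℓ} → Field c ℓ → Set ℓ
CharNot2 K = ¬ ((1# + 1#) ≈ 0#) where open Field K

module _ {c ℓ} (K : Field c ℓ) where
  open Field K using (0#; 1#) renaming (Carrier to F; _≈_ to _≈F_; _+_ to _+F_; _*_ to _*F_; -_ to -F_)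

  -- Polynomial ring F[ε, x₀, x₁, …]: terms modulo the laws of a
  -- commutative F-algebra (this quotient is the free commutative
  -- F-algebra on ε and the xᵢ, i.e. the polynomial ring).

  data Tm : Set c where
    const : F → Tm
    eps   : Tm
    var   : ℕ → Tm
    _⊕_   : Tm → Tm → Tm
    _⊗_   : Tm → Tm → Tm
    ⊖_    : Tm → Tm

  infixl 6 _⊕_
  infixl 7 _⊗_

  𝟘 𝟙 : Tm
  𝟘 = const 0#
  𝟙 = const 1#

  infix 4 _∼_
  data _∼_ : Tm → Tm → Set (c ⊔ ℓ) where
    ∼-refl  : ∀ {a} → a ∼ a
    ∼-sym   : ∀ {a b} → a ∼ b → b ∼ a
    ∼-trans : ∀ {a b e} → a ∼ b → b ∼ e → a ∼ e
    ⊕-cong  : ∀ {a b a' b'} → a ∼ a' → b ∼ b' → a ⊕ b ∼ a' ⊕ b'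
    ⊗-cong  : ∀ {a b a' b'} → a ∼ a' → b ∼ b' → a ⊗ b ∼ a' ⊗ b'
    ⊖-cong  : ∀ {a a'} → a ∼ a' → ⊖ a ∼ ⊖ a'
    ⊕-assoc : ∀ a b e → (a ⊕ b) ⊕ e ∼ a ⊕ (b ⊕ e)
    ⊕-comm  : ∀ a b → a ⊕ b ∼ b ⊕ a
    ⊕-idˡ   : ∀ a → 𝟘 ⊕ a ∼ a
    ⊖-invˡ  : ∀ a → (⊖ a) ⊕ a ∼ 𝟘
    ⊗-assoc : ∀ a b e → (a ⊗ b) ⊗ e ∼ a ⊗ (b ⊗ e)
    ⊗-comm  : ∀ a b → a ⊗ b ∼ b ⊗ a
    ⊗-idˡ   : ∀ a → 𝟙 ⊗ a ∼ a
    distribˡ : ∀ a b e → a ⊗ (b ⊕ e) ∼ (a ⊗ b) ⊕ (a ⊗ e)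
    -- the constants form a copy of F
    const-cong : ∀ {a b} → a ≈F b → const a ∼ const b
    const-+ : ∀ a b → const a ⊕ const b ∼ const (a +F b)
    const-* : ∀ a b → const a ⊗ const b ∼ const (a *F b)
    const-- : ∀ a → ⊖ const a ∼ const (-F a)

  -- terms not mentioning any xᵢ: elements of F[ε]
  data EpsOnly : Tm → Set c where
    const : ∀ a → EpsOnly (const a)
    eps   : EpsOnly eps
    _⊕_   : ∀ {a b} → EpsOnly a → EpsOnly b → EpsOnly (a ⊕ b)
    _⊗_   : ∀ {a b} → EpsOnly a → EpsOnly b → EpsOnly (a ⊗ b)
    ⊖_    : ∀ {a} → EpsOnly a → EpsOnly (⊖ a)

  -- terms not mentioning ε: elements of F[x₀, x₁, …]
  data EpsFree : Tm → Set c where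
    const : ∀ a → EpsFree (const a)
    var   : ∀ i → EpsFree (var i)
    _⊕_   : ∀ {a b} → EpsFree a → EpsFree b → EpsFree (a ⊕ b)
    _⊗_   : ∀ {a b} → EpsFree a → EpsFree b → EpsFree (a ⊗ b)
    ⊖_    : ∀ {a} → EpsFree a → EpsFree (⊖ a)

  -- F(ε)[x]: fractions p / q with p ∈ F[ε,x], q ∈ F[ε] ∖ {0}
  -- (well-formedness of denominators is imposed where fractions are
  -- introduced; all operations below preserve it since F[ε,x] is a domain).

  Frac : Set c
  Frac = Tm × Tm      -- (numerator , denominator)

  infix 4 _≈Q_
  _≈Q_ : Frac → Frac → Set (c ⊔ ℓ)
  (p , q) ≈Q (p' , q') = p ⊗ q' ∼ p' ⊗ q

  _+Q_ _*Q_ : Frac → Frac → Frac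
  (p , q) +Q (p' , q') = (p ⊗ q' ⊕ p' ⊗ q , q ⊗ q')
  (p , q) *Q (p' , q') = (p ⊗ p' , q ⊗ q')

  ι : Tm → Frac
  ι p = (p , 𝟙)

  record Coeff : Set (c ⊔ ℓ) where
    constructor _/_∣_,_,_
    field
      num    : Tm
      den    : Tm
      numOK  : EpsOnly num
      denOK  : EpsOnly den
      den≠0  : ¬ (den ∼ 𝟘)

  coeff : Coeff → Frac
  coeff k = (Coeff.num k , Coeff.den k)

  record PALF : Set (c ⊔ ℓ) where
    field
      constTerm : Coeff
      linTerms  : List (ℕ × Coeff)

  ⟦_⟧L : PALF → Frac
  ⟦ L ⟧L = foldr (λ { (i , k) acc → (coeff k *Q ι (var i)) +Q acc })
                 (coeff (PALF.constTerm L)) (PALF.linTerms L)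

  record Mat2 (A : Set c) : Set c where
    constructor mat
    field
      m₁₁ m₁₂ m₂₁ m₂₂ : A

  _·Q_ : Mat2 Frac → Mat2 Frac → Mat2 Frac
  mat a b e f ·Q mat a' b' e' f' =
    mat ((a *Q a') +Q (b *Q e')) ((a *Q b') +Q (b *Q f'))
        ((e *Q a') +Q (f *Q e')) ((e *Q b') +Q (f *Q f'))

  I₂ : Mat2 Frac
  I₂ = mat (ι 𝟙) (ι 𝟘) (ι 𝟘) (ι 𝟙)

  prodQ : List (Mat2 Frac) → Mat2 Frac
  prodQ = foldr _·Q_ I₂

  embed : Mat2 Tm → Mat2 Frac
  embed (mat a b e f) = mat (ι a) (ι b) (ι e) (ι f)

  _≈M_ : Mat2 Frac → Mat2 Frac → Set (c ⊔ ℓ)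
  mat a b e f ≈M mat a' b' e' f' = (a ≈Q a') × (b ≈Q b') × (e ≈Q e') × (f ≈Q f')

  Qpoly : Tm → Mat2 Tm
  Qpoly h = mat h 𝟙 𝟙 𝟘

  Qprim : PALF → Mat2 Frac
  Qprim L = mat ⟦ L ⟧L (ι 𝟙) (ι 𝟙) (ι 𝟘)

  InO : Tm → Set (c ⊔ ℓ)
  InO t = ∃ λ r → t ∼ eps ⊗ r

  _∈_+O : Mat2 Tm → Mat2 Tm → Set (c ⊔ ℓ)
  mat a b e f ∈ mat a' b' e' f' +O =
    InO (a ⊕ ⊖ a') × InO (b ⊕ ⊖ b') × InO (e ⊕ ⊖ e') × InO (f ⊕ ⊖ f')

  EpsDeg≤ : ℕ → Tm → Set (c ⊔ ℓ)
  EpsDeg≤ zero    t = ∃ λ p → EpsFree p × (t ∼ p)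
  EpsDeg≤ (suc k) t = ∃ λ p → ∃ λ r → EpsFree p × EpsDeg≤ k r × (t ∼ p ⊕ eps ⊗ r)

  ErrDeg≤ : ℕ → Mat2 Tm → Set (c ⊔ ℓ)
  ErrDeg≤ k (mat a b e f) = EpsDeg≤ k a × EpsDeg≤ k b × EpsDeg≤ k e × EpsDeg≤ k f

  data Formula : Set c where
    leafVar   : ℕ → Formula
    leafConst : F → Formula
    plus      : Formula → Formula → Formula
    times     : Formula → Formula → Formula

  depth : Formula → ℕ
  depth (leafVar _)   = 0
  depth (leafConst _) = 0
  depth (plus φ ψ)    = suc (max (depth φ) (depth ψ))
  depth (times φ ψ)   = suc (max (depth φ) (depth ψ))

  ⟦_⟧F : Formula → Tm
  ⟦ leafVar i ⟧F   = var i
  ⟦ leafConst a ⟧F = const a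
  ⟦ plus φ ψ ⟧F    = ⟦ φ ⟧F ⊕ ⟦ ψ ⟧F
  ⟦ times φ ψ ⟧F   = ⟦ φ ⟧F ⊗ ⟦ ψ ⟧F

module Submission where

open import Defs
open import Data.Nat using (ℕ; _≤_; _*_; _^_)
open import Data.Nat.Properties using (≤-trans; ≤-reflexive)
open import Data.Product using (∃; _×_; _,_)
open import Data.List using (List; length; map)
open import Relation.Binary.PropositionalEquality using (_≡_)

-- For a formula φ and a precision
-- exponent p we build, by induction on φ, a product of primitive Q-matrices
-- equal to Q(α·φ) + ε^p·E with E a polynomial matrix of controlled ε-degree:
--   * a leaf is a single primitive Q(α·xᵢ) or Q(α·a);
--   * a sum uses  Q(a + ε^p E) · Q(0) · Q(b + ε^p F) = Q(a + b) + ε^p E';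
--   * a product uses polarization  α f g = λ(f + g)² - λ(f - g)²  (λ = α/4,
--     which needs char 𝔽 ≠ 2), each square coming from the gadget
--     diag(-1,t²)/t · Q(h + t³E) · Q(λt²) · Q(-h + t³F) · diag(1,-t²)/t
--       = Q(λh²) + t·E'   (t = ε^p),
--     where the diagonal factors are themselves products of three primitives.
-- Working at precision ε^{3p} inside squares makes the error degree grow as
-- p·(31 + 24·e) and the number of primitives as 19 + 8·s per level, whence
-- the bounds 12·25^d and 45·9^d at p = 1.

-- The polynomial ring F[ε, x₀, x₁, …] and a ring solver for it.
module TermRing {c ℓ} (K : Field c ℓ) where

  open import Level using (_⊔_)
  open import Data.Nat as ℕ using (zero; suc)
  import Data.Nat.Properties as ℕ
  open import Data.Integer as ℤ using (ℤ; +_; -[1+_]; _⊖_)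
  import Data.Integer.Properties as ℤ
  open import Data.Sign as Sign using (Sign)
  open import Data.Product using (_,_)
  open import Data.Maybe using (Maybe; just; nothing)
  open import Relation.Binary.PropositionalEquality as ≡ using (_≡_)
  open import Relation.Nullary using (yes; no)
  open import Algebra.Bundles using (CommutativeRing)
  open import Algebra.Structures using (IsCommutativeRing)
  open import Algebra.Solver.Ring.AlmostCommutativeRing as ACR
    using (_-Raw-AlmostCommutative⟶_)
  import Algebra.Solver.Ring
  import Relation.Binary.Reasoning.Setoid

  Pol : Set c
  Pol = Tm K

  infix 4 _≃_
  _≃_ : Pol → Pol → Set (c ⊔ ℓ)
  _≃_ = _∼_ K

  0ₚ 1ₚ : Pol
  0ₚ = 𝟘 K
  1ₚ = 𝟙 K

  isCommutativeRing : IsCommutativeRing _≃_ _⊕_ _⊗_ ⊖_ 0ₚ 1ₚ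
  isCommutativeRing = record
    { isRing = record
      { +-isAbelianGroup = record
        { isGroup = record
          { isMonoid = record
            { isSemigroup = record
              { isMagma = record
                { isEquivalence = record { refl = ∼-refl ; sym = ∼-sym ; trans = ∼-trans }
                ; ∙-cong = ⊕-cong }
              ; assoc = ⊕-assoc }
            ; identity = ⊕-idˡ , λ a → ∼-trans (⊕-comm a 0ₚ) (⊕-idˡ a) }
          ; inverse = ⊖-invˡ , λ a → ∼-trans (⊕-comm a (⊖ a)) (⊖-invˡ a)
          ; ⁻¹-cong = ⊖-cong }
        ; comm = ⊕-comm }
      ; *-cong = ⊗-cong
      ; *-assoc = ⊗-assoc
      ; *-identity = ⊗-idˡ , λ a → ∼-trans (⊗-comm a 1ₚ) (⊗-idˡ a)
      ; distrib = distribˡ , λ a b e → ∼-trans (⊗-comm (b ⊕ e) a)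
                    (∼-trans (distribˡ a b e) (⊕-cong (⊗-comm a b) (⊗-comm a e))) }
    ; *-comm = ⊗-comm }

  polyRing : CommutativeRing c (c ⊔ ℓ)
  polyRing = record { isCommutativeRing = isCommutativeRing }

  open CommutativeRing polyRing public
    using (+-identityʳ; *-identityʳ; zeroʳ)
  open CommutativeRing polyRing using (-‿inverseʳ)
  module Reasoning = Relation.Binary.Reasoning.Setoid (CommutativeRing.setoid polyRing)
  open import Algebra.Properties.CommutativeSemigroup (CommutativeRing.*-commutativeSemigroup polyRing)
    public using (interchange)
  open import Algebra.Properties.CommutativeSemigroup (CommutativeRing.+-commutativeSemigroup polyRing)
    using () renaming (interchange to +-interchange)
  open import Algebra.Properties.Ring (CommutativeRing.ring polyRing)
    using (-‿involutive; -0#≈0#; -‿distribˡ-*; -‿+-comm)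
  open import Algebra.Properties.Semiring.Mult.TCOptimised (CommutativeRing.semiring polyRing)
    using (×-homo-+; ×1-homo-*) renaming (_×_ to _·1_)

  ≡⇒≃ : ∀ {a b} → a ≡ b → a ≃ b
  ≡⇒≃ ≡.refl = ∼-refl

  -- The canonical ring homomorphism ℤ → Tm; it lets the ring solver with
  -- integer coefficients normalise identities in Tm.
  fromℕ : ℕ → Pol
  fromℕ n = n ·1 1ₚ

  fromℕ-suc : ∀ n → fromℕ (suc n) ≃ 1ₚ ⊕ fromℕ n
  fromℕ-suc n = ×-homo-+ 1ₚ 1 n

  fromℤ : ℤ → Pol
  fromℤ (+ n)      = fromℕ n
  fromℤ -[1+ n ]   = ⊖ fromℕ (suc n)

  fromℤ-⊖ : ∀ m n → fromℤ (m ⊖ n) ≃ fromℕ m ⊕ ⊖ fromℕ n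
  fromℤ-⊖ zero    zero    = ∼-sym (∼-trans (⊕-idˡ _) -0#≈0#)
  fromℤ-⊖ zero    (suc n) = ∼-sym (⊕-idˡ _)
  fromℤ-⊖ (suc m) zero    = ∼-sym (∼-trans (⊕-cong ∼-refl -0#≈0#) (+-identityʳ _))
  fromℤ-⊖ (suc m) (suc n) =
    ∼-trans (≡⇒≃ (≡.cong fromℤ (ℤ.[1+m]⊖[1+n]≡m⊖n m n)))
            (∼-trans (fromℤ-⊖ m n) (∼-sym (∼-trans (⊕-cong (fromℕ-suc m) (⊖-cong (fromℕ-suc n)))
                                                    (cancel (fromℕ m) (fromℕ n)))))
    where
    cancel : ∀ x y → (1ₚ ⊕ x) ⊕ ⊖ (1ₚ ⊕ y) ≃ x ⊕ ⊖ y
    cancel x y = begin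
      (1ₚ ⊕ x) ⊕ ⊖ (1ₚ ⊕ y)      ≈⟨ ⊕-cong ∼-refl (∼-sym (-‿+-comm 1ₚ y)) ⟩
      (1ₚ ⊕ x) ⊕ (⊖ 1ₚ ⊕ ⊖ y)   ≈⟨ +-interchange 1ₚ x (⊖ 1ₚ) (⊖ y) ⟩
      (1ₚ ⊕ ⊖ 1ₚ) ⊕ (x ⊕ ⊖ y)   ≈⟨ ⊕-cong (-‿inverseʳ 1ₚ) ∼-refl ⟩
      0ₚ ⊕ (x ⊕ ⊖ y)             ≈⟨ ⊕-idˡ _ ⟩
      x ⊕ ⊖ y                    ∎
      where open Reasoning

  fromℤ-+ : ∀ z w → fromℤ (z ℤ.+ w) ≃ fromℤ z ⊕ fromℤ w
  fromℤ-+ (+ m)    (+ n)    = ×-homo-+ 1ₚ m n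
  fromℤ-+ (+ m)    -[1+ n ] = fromℤ-⊖ m (suc n)
  fromℤ-+ -[1+ m ] (+ n)    = ∼-trans (fromℤ-⊖ n (suc m)) (⊕-comm _ _)
  fromℤ-+ -[1+ m ] -[1+ n ] =
    ∼-trans (⊖-cong (∼-trans (≡⇒≃ (≡.cong (λ k → fromℕ (suc k)) (≡.sym (ℕ.+-suc m n))))
                              (×-homo-+ 1ₚ (suc m) (suc n))))
            (∼-sym (-‿+-comm _ _))

  fromℤ-neg : ∀ z → fromℤ (ℤ.- z) ≃ ⊖ fromℤ z
  fromℤ-neg (+ zero)  = ∼-sym -0#≈0#
  fromℤ-neg (+ suc n) = ∼-refl
  fromℤ-neg -[1+ n ]  = ∼-sym (-‿involutive _)

  -- multiplicativity, via the decomposition z = sign z ◃ ∣ z ∣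
  fromSign : Sign → Pol
  fromSign Sign.+ = 1ₚ
  fromSign Sign.- = ⊖ 1ₚ

  fromSign-* : ∀ s t → fromSign (s Sign.* t) ≃ fromSign s ⊗ fromSign t
  fromSign-* Sign.+ t      = ∼-sym (⊗-idˡ _)
  fromSign-* Sign.- Sign.+ = ∼-sym (*-identityʳ _)
  fromSign-* Sign.- Sign.- =
    ∼-sym (∼-trans (∼-sym (-‿distribˡ-* 1ₚ (⊖ 1ₚ))) (∼-trans (⊖-cong (⊗-idˡ _)) (-‿involutive 1ₚ)))

  fromℤ-◃ : ∀ s n → fromℤ (s ℤ.◃ n) ≃ fromSign s ⊗ fromℕ n
  fromℤ-◃ s      zero    = ∼-sym (zeroʳ _)
  fromℤ-◃ Sign.+ (suc n) = ∼-sym (⊗-idˡ _)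
  fromℤ-◃ Sign.- (suc n) = ∼-trans (⊖-cong (∼-sym (⊗-idˡ _))) (-‿distribˡ-* 1ₚ _)

  fromℤ-signAbs : ∀ z → fromℤ z ≃ fromSign (ℤ.sign z) ⊗ fromℕ ℤ.∣ z ∣
  fromℤ-signAbs z =
    ∼-trans (≡⇒≃ (≡.cong fromℤ (≡.sym (ℤ.◃-inverse z)))) (fromℤ-◃ (ℤ.sign z) ℤ.∣ z ∣)

  fromℤ-* : ∀ z w → fromℤ (z ℤ.* w) ≃ fromℤ z ⊗ fromℤ w
  fromℤ-* z w =
    ∼-trans (fromℤ-◃ (ℤ.sign z Sign.* ℤ.sign w) (ℤ.∣ z ∣ ℕ.* ℤ.∣ w ∣))
    (∼-trans (⊗-cong (fromSign-* _ _) (×1-homo-* ℤ.∣ z ∣ ℤ.∣ w ∣))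
    (∼-trans (interchange _ _ _ _) (∼-sym (⊗-cong (fromℤ-signAbs z) (fromℤ-signAbs w)))))

  fromℤ-morphism : ℤ.+-*-rawRing -Raw-AlmostCommutative⟶ ACR.fromCommutativeRing polyRing
  fromℤ-morphism = record
    { ⟦_⟧ = fromℤ ; +-homo = fromℤ-+ ; *-homo = fromℤ-* ; -‿homo = fromℤ-neg
    ; 0-homo = ∼-refl ; 1-homo = ∼-refl }

  fromℤ-≟ : ∀ a b → Maybe (fromℤ a ≃ fromℤ b)
  fromℤ-≟ a b with a ℤ.≟ b
  ... | yes a≡b = just (≡⇒≃ (≡.cong fromℤ a≡b))
  ... | no _    = nothing

  open Algebra.Solver.Ring ℤ.+-*-rawRing (ACR.fromCommutativeRing polyRing) fromℤ-morphism fromℤ-≟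
    public using (Polynomial; solve; _:=_; _:+_; _:*_; :-_; _:-_; con)

  :0 :1 : ∀ {n} → Polynomial n
  :0 = con (+ 0)
  :1 = con (+ 1)

-- The matrix identities of the construction are
-- written once over it and interpreted in the polynomial ring, as solver
-- expressions (to prove them) and as degree expressions (to bound ε-degrees).
record RingOps {a} (A : Set a) : Set a where
  infixl 6 _⊞_
  infixl 7 _⊠_
  field
    _⊞_ _⊠_ : A → A → A
    ⊟_      : A → A
    zer one : A

record M2 {a} (A : Set a) : Set a where
  constructor mk
  field e₁₁ e₁₂ e₂₁ e₂₂ : A

module MatrixOps {a} {A : Set a} (R : RingOps A) where
  open import Data.Nat using (zero; suc)
  open RingOps R

  infixl 7 _·_
  _·_ : M2 A → M2 A → M2 A
  mk a b e f · mk a' b' e' f' =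
    mk (a ⊠ a' ⊞ b ⊠ e') (a ⊠ b' ⊞ b ⊠ f') (e ⊠ a' ⊞ f ⊠ e') (e ⊠ b' ⊞ f ⊠ f')

  scale : A → M2 A → M2 A
  scale D (mk a b e f) = mk (D ⊠ a) (D ⊠ b) (D ⊠ e) (D ⊠ f)

  perturbedQ : A → A → M2 A → M2 A
  perturbedQ h t (mk a b e f) = mk (h ⊞ t ⊠ a) (one ⊞ t ⊠ b) (one ⊞ t ⊠ e) (zer ⊞ t ⊠ f)

  -- powers, with pw t 1 = t on the nose
  pw : A → ℕ → A
  pw t zero          = one
  pw t (suc zero)    = t
  pw t (suc (suc k)) = t ⊠ pw t (suc k)

  -- Addition gadget:  Q(a + tE) · Q(0) · Q(b + tF) = Q(a + b) + t·sumError,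
  -- stated with the denominators DA, DB of the two factors.
  sumError : A → A → A → M2 A → M2 A → M2 A
  sumError a b t (mk e1 e2 e3 e4) (mk f1 f2 f3 f4) =
    mk (e1 ⊞ e2 ⊠ b ⊞ f1 ⊞ a ⊠ f3 ⊞ t ⊠ (e1 ⊠ f3 ⊞ e2 ⊠ f1))
       (e2 ⊞ f2 ⊞ a ⊠ f4 ⊞ t ⊠ (e1 ⊠ f4 ⊞ e2 ⊠ f2))
       (e3 ⊞ e4 ⊠ b ⊞ f3 ⊞ t ⊠ (e3 ⊠ f3 ⊞ e4 ⊠ f1))
       (e4 ⊞ f4 ⊞ t ⊠ (e3 ⊠ f4 ⊞ e4 ⊠ f2))

  sumLHS sumRHS : A → A → A → A → A → M2 A → M2 A → M2 A
  sumLHS DA DB a b t E F =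
    scale DA (perturbedQ a t E) · (mk zer one one zer · scale DB (perturbedQ b t F))
  sumRHS DA DB a b t E F = scale (DA ⊠ (one ⊠ DB)) (perturbedQ (a ⊞ b) t (sumError a b t E F))

  -- Squaring gadget (with t³ in the inner approximations):
  --   diag(-1, t²) · Q(h + t³E) · Q(λt²) · Q(-h + t³F) · diag(1, -t²)
  --     = t² · (Q(λh²) + t·squareError),
  -- again stated with the denominators DA, DB of the inner factors.
  squareError : A → A → A → M2 A → M2 A → M2 A
  squareError t h l (mk e1 e2 e3 e4) (mk f1 f2 f3 f4) = mk
    (⊟ f1 ⊞ (⊟ e1 ⊞ (⊟ (h ⊠ f3) ⊞ (h ⊠ e2 ⊞ (⊟ (pw t 2 ⊠ (h ⊠ (l ⊠ f1))) ⊞ (pw t 2 ⊠ (h ⊠ (l ⊠ e1))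
      ⊞ (⊟ (pw t 3 ⊠ (e2 ⊠ f1)) ⊞ (⊟ (pw t 3 ⊠ (e1 ⊠ f3)) ⊞ ⊟ (pw t 5 ⊠ (l ⊠ (e1 ⊠ f1)))))))))))
    (pw t 1 ⊠ (h ⊠ l) ⊞ (pw t 2 ⊠ f2 ⊞ (pw t 2 ⊠ e2 ⊞ (pw t 2 ⊠ (h ⊠ f4) ⊞ (pw t 4 ⊠ (l ⊠ e1)
      ⊞ (pw t 4 ⊠ (h ⊠ (l ⊠ f2)) ⊞ (pw t 5 ⊠ (e2 ⊠ f2) ⊞ (pw t 5 ⊠ (e1 ⊠ f4) ⊞ pw t 7 ⊠ (l ⊠ (e1 ⊠ f2))))))))))
    (⊟ (pw t 1 ⊠ (h ⊠ l)) ⊞ (pw t 2 ⊠ f3 ⊞ (pw t 2 ⊠ e3 ⊞ (⊟ (pw t 2 ⊠ (h ⊠ e4)) ⊞ (pw t 4 ⊠ (l ⊠ f1)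
      ⊞ (⊟ (pw t 4 ⊠ (h ⊠ (l ⊠ e3))) ⊞ (pw t 5 ⊠ (e4 ⊠ f1) ⊞ (pw t 5 ⊠ (e3 ⊠ f3) ⊞ pw t 7 ⊠ (l ⊠ (e3 ⊠ f1))))))))))
    (⊟ (pw t 3 ⊠ l) ⊞ (⊟ (pw t 4 ⊠ f4) ⊞ (⊟ (pw t 4 ⊠ e4) ⊞ (⊟ (pw t 6 ⊠ (l ⊠ f2)) ⊞ (⊟ (pw t 6 ⊠ (l ⊠ e3))
      ⊞ (⊟ (pw t 7 ⊠ (e4 ⊠ f2)) ⊞ (⊟ (pw t 7 ⊠ (e3 ⊠ f4)) ⊞ ⊟ (pw t 9 ⊠ (l ⊠ (e3 ⊠ f2))))))))))

  squareLHS squareRHS : A → A → A → A → A → M2 A → M2 A → M2 A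
  squareLHS DA DB t h l E F =
    mk (⊟ one) zer zer (t ⊠ t) · (scale DA (perturbedQ h (t ⊠ (t ⊠ t)) E)
      · (mk (l ⊠ (t ⊠ t)) one one zer · (scale DB (perturbedQ (⊟ h) (t ⊠ (t ⊠ t)) F)
      · mk one zer zer (⊟ t ⊠ t))))
  squareRHS DA DB t h l E F =
    scale (t ⊠ (DA ⊠ (one ⊠ (DB ⊠ t)))) (perturbedQ (l ⊠ (h ⊠ h)) t (squareError t h l E F))

-- Products of primitive Q-matrices, computed with a common polynomial
-- denominator.
module PrimitiveProducts {c ℓ} (K : Field c ℓ) where

  open import Level using (_⊔_)
  import Data.Nat
  open import Data.Product using (∃; _×_; _,_; proj₁; proj₂)
  open import Data.List using (List; []; _∷_; _++_; foldr; map; length)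
  import Data.List.Properties as List
  open import Relation.Binary.PropositionalEquality using (_≡_)
  open TermRing K public

  polyOps : RingOps Pol
  polyOps = record { _⊞_ = _⊕_ ; _⊠_ = _⊗_ ; ⊟_ = ⊖_ ; zer = 0ₚ ; one = 1ₚ }

  open MatrixOps polyOps public

  PMat : Set c
  PMat = M2 Pol

  infix 4 _≈ₘ_
  _≈ₘ_ : PMat → PMat → Set (c ⊔ ℓ)
  mk a b e f ≈ₘ mk a' b' e' f' = (a ≃ a') × (b ≃ b') × (e ≃ e') × (f ≃ f')

  ≈ₘ-refl : ∀ {A} → A ≈ₘ A
  ≈ₘ-refl {mk _ _ _ _} = ∼-refl , ∼-refl , ∼-refl , ∼-refl

  ≈ₘ-trans : ∀ {A B C} → A ≈ₘ B → B ≈ₘ C → A ≈ₘ C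
  ≈ₘ-trans {mk _ _ _ _} {mk _ _ _ _} {mk _ _ _ _} (a , b , e , f) (a' , b' , e' , f') =
    ∼-trans a a' , ∼-trans b b' , ∼-trans e e' , ∼-trans f f'

  ·-cong : ∀ {A A' B B'} → A ≈ₘ A' → B ≈ₘ B' → A · B ≈ₘ A' · B'
  ·-cong {mk _ _ _ _} {mk _ _ _ _} {mk _ _ _ _} {mk _ _ _ _} (a , b , e , f) (a' , b' , e' , f') =
    ⊕-cong (⊗-cong a a') (⊗-cong b e') , ⊕-cong (⊗-cong a b') (⊗-cong b f') ,
    ⊕-cong (⊗-cong e a') (⊗-cong f e') , ⊕-cong (⊗-cong e b') (⊗-cong f f')

  ·-assoc : ∀ A B C → A · (B · C) ≈ₘ (A · B) · C
  ·-assoc (mk a b e f) (mk a' b' e' f') (mk a'' b'' e'' f'') =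
    entry a b a' b' e' f' a'' e'' , entry a b a' b' e' f' b'' f'' ,
    entry e f a' b' e' f' a'' e'' , entry e f a' b' e' f' b'' f''
    where
    entry : ∀ a b a' b' e' f' a'' e'' →
      a ⊗ (a' ⊗ a'' ⊕ b' ⊗ e'') ⊕ b ⊗ (e' ⊗ a'' ⊕ f' ⊗ e'')
        ≃ (a ⊗ a' ⊕ b ⊗ e') ⊗ a'' ⊕ (a ⊗ b' ⊕ b ⊗ f') ⊗ e''
    entry = solve 8 (λ a b a' b' e' f' a'' e'' →
      a :* (a' :* a'' :+ b' :* e'') :+ b :* (e' :* a'' :+ f' :* e'')
        := (a :* a' :+ b :* e') :* a'' :+ (a :* b' :+ b :* f') :* e'') ∼-refl

  -- A fraction x represents N / D when x = (N·u) / (D·u) for some u.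
  -- Keeping the common factor u explicit avoids cancellation, which is
  -- not available for cross-multiplication equality on Tm.

  Represents : Frac K → Pol → Pol → Set (c ⊔ ℓ)
  Represents x N D = ∃ λ u → (proj₂ x ≃ D ⊗ u) × (proj₁ x ≃ N ⊗ u)

  represents-cong : ∀ {x N N' D D'} → N ≃ N' → D ≃ D' → Represents x N D → Represents x N' D'
  represents-cong eN eD (u , den , num) = u , ∼-trans den (⊗-cong eD ∼-refl) , ∼-trans num (⊗-cong eN ∼-refl)

  represents-cancel : ∀ {x N' D'} C N D → N' ≃ C ⊗ N → D' ≃ C ⊗ D →
                      Represents x N' D' → Represents x N D
  represents-cancel C N D eN eD (u , den , num) =
    C ⊗ u , ∼-trans den (∼-trans (⊗-cong eD ∼-refl) (shift C D u)) ,
            ∼-trans num (∼-trans (⊗-cong eN ∼-refl) (shift C N u))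
    where
    shift : ∀ C D u → (C ⊗ D) ⊗ u ≃ D ⊗ (C ⊗ u)
    shift = solve 3 (λ C D u → (C :* D) :* u := D :* (C :* u)) ∼-refl

  represents-+ : ∀ {x y N₁ D₁ N₂ D₂} → Represents x N₁ D₁ → Represents y N₂ D₂ →
                 Represents (_+Q_ K x y) (N₁ ⊗ D₂ ⊕ N₂ ⊗ D₁) (D₁ ⊗ D₂)
  represents-+ {N₁ = N₁} {D₁} {N₂} {D₂} (u₁ , den₁ , num₁) (u₂ , den₂ , num₂) =
    u₁ ⊗ u₂ , ∼-trans (⊗-cong den₁ den₂) (interchange D₁ u₁ D₂ u₂) ,
    ∼-trans (⊕-cong (⊗-cong num₁ den₂) (⊗-cong num₂ den₁)) (sumNum N₁ u₁ D₂ u₂ N₂ D₁)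
    where
    sumNum : ∀ N₁ u₁ D₂ u₂ N₂ D₁ →
      (N₁ ⊗ u₁) ⊗ (D₂ ⊗ u₂) ⊕ (N₂ ⊗ u₂) ⊗ (D₁ ⊗ u₁) ≃ (N₁ ⊗ D₂ ⊕ N₂ ⊗ D₁) ⊗ (u₁ ⊗ u₂)
    sumNum = solve 6 (λ N₁ u₁ D₂ u₂ N₂ D₁ →
      (N₁ :* u₁) :* (D₂ :* u₂) :+ (N₂ :* u₂) :* (D₁ :* u₁) := (N₁ :* D₂ :+ N₂ :* D₁) :* (u₁ :* u₂)) ∼-refl

  represents-* : ∀ {x y N₁ D₁ N₂ D₂} → Represents x N₁ D₁ → Represents y N₂ D₂ →
                 Represents (_*Q_ K x y) (N₁ ⊗ N₂) (D₁ ⊗ D₂)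
  represents-* {N₁ = N₁} {D₁} {N₂} {D₂} (u₁ , den₁ , num₁) (u₂ , den₂ , num₂) =
    u₁ ⊗ u₂ , ∼-trans (⊗-cong den₁ den₂) (interchange D₁ u₁ D₂ u₂) ,
              ∼-trans (⊗-cong num₁ num₂) (interchange N₁ u₁ N₂ u₂)

  represents-pair : ∀ n q → Represents (n , q) n q
  represents-pair n q = 1ₚ , ∼-sym (*-identityʳ q) , ∼-sym (*-identityʳ n)

  represents-ι : ∀ a → Represents (ι K a) a 1ₚ
  represents-ι a = represents-pair a 1ₚ

  represents⇒≈Q : ∀ {x N D m} → Represents x N D → N ≃ D ⊗ m → _≈Q_ K x (ι K m)
  represents⇒≈Q {D = D} {m} (u , den , num) N≃Dm =
    ∼-trans (*-identityʳ _) (∼-trans num (∼-trans (⊗-cong N≃Dm ∼-refl)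
      (∼-trans (regroup D m u) (⊗-cong ∼-refl (∼-sym den)))))
    where
    regroup : ∀ D m u → (D ⊗ m) ⊗ u ≃ m ⊗ (D ⊗ u)
    regroup = solve 3 (λ D m u → (D :* m) :* u := m :* (D :* u)) ∼-refl

  RepresentsM : Mat2 K (Frac K) → PMat → Pol → Set (c ⊔ ℓ)
  RepresentsM (mat x₁₁ x₁₂ x₂₁ x₂₂) (mk N₁₁ N₁₂ N₂₁ N₂₂) D =
    Represents x₁₁ N₁₁ D × Represents x₁₂ N₁₂ D × Represents x₂₁ N₂₁ D × Represents x₂₂ N₂₂ D

  representsM-cong : ∀ {X N N' D D'} → N ≈ₘ N' → D ≃ D' → RepresentsM X N D → RepresentsM X N' D'
  representsM-cong {mat _ _ _ _} {mk _ _ _ _} {mk _ _ _ _} (e₁ , e₂ , e₃ , e₄) eD (r₁ , r₂ , r₃ , r₄) =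
    represents-cong e₁ eD r₁ , represents-cong e₂ eD r₂ ,
    represents-cong e₃ eD r₃ , represents-cong e₄ eD r₄

  topRow : PALF K → Frac K → Frac K → Frac K
  topRow L x₁ x₂ = _+Q_ K (_*Q_ K (⟦_⟧L K L) x₁) (_*Q_ K (ι K 1ₚ) x₂)

  bottomRow : Frac K → Frac K → Frac K
  bottomRow x₁ x₂ = _+Q_ K (_*Q_ K (ι K 1ₚ) x₁) (_*Q_ K (ι K 0ₚ) x₂)

  topRow-represents : ∀ {L l dₗ x₁ N₁ D₁ x₂ N₂ D₂} → Represents (⟦_⟧L K L) l dₗ →
    Represents x₁ N₁ D₁ → Represents x₂ N₂ D₂ → ∀ C N D →
    (l ⊗ N₁) ⊗ (1ₚ ⊗ D₂) ⊕ (1ₚ ⊗ N₂) ⊗ (dₗ ⊗ D₁) ≃ C ⊗ N → (dₗ ⊗ D₁) ⊗ (1ₚ ⊗ D₂) ≃ C ⊗ D →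
    Represents (topRow L x₁ x₂) N D
  topRow-represents rL r₁ r₂ C N D eN eD =
    represents-cancel C N D eN eD (represents-+ (represents-* rL r₁) (represents-* (represents-ι 1ₚ) r₂))

  bottomRow-represents : ∀ {x₁ N₁ D₁ x₂ N₂ D₂} → Represents x₁ N₁ D₁ → Represents x₂ N₂ D₂ →
    ∀ C N D → (1ₚ ⊗ N₁) ⊗ (1ₚ ⊗ D₂) ⊕ (0ₚ ⊗ N₂) ⊗ (1ₚ ⊗ D₁) ≃ C ⊗ N →
    (1ₚ ⊗ D₁) ⊗ (1ₚ ⊗ D₂) ≃ C ⊗ D → Represents (bottomRow x₁ x₂) N D
  bottomRow-represents r₁ r₂ C N D eN eD =
    represents-cancel C N D eN eD (represents-+ (represents-* (represents-ι 1ₚ) r₁) (represents-* (represents-ι 0ₚ) r₂))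

  -- A list of primitive Q-matrices together with a polynomial matrix num
  -- and polynomial den such that their product "is" num / den: multiplying
  -- any represented matrix N / D by it gives (num · N) / (den · D).

  record PrimProduct : Set (c ⊔ ℓ) where
    field
      prims : List (PALF K)
      num   : PMat
      den   : Pol
      acts  : ∀ X N D → RepresentsM X N D →
              RepresentsM (foldr (_·Q_ K) X (map (Qprim K) prims)) (num · N) (den ⊗ D)
  open PrimProduct public

  single : (L : PALF K) (l : Pol) → Represents (⟦_⟧L K L) l 1ₚ → PrimProduct
  single L l rL = record { prims = L ∷ [] ; num = mk l 1ₚ 1ₚ 0ₚ ; den = 1ₚ ; acts = acts′ }
    where
    top : ∀ l N₁ N₂ D → (l ⊗ N₁) ⊗ (1ₚ ⊗ D) ⊕ (1ₚ ⊗ N₂) ⊗ (1ₚ ⊗ D) ≃ D ⊗ (l ⊗ N₁ ⊕ 1ₚ ⊗ N₂)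
    top = solve 4 (λ l N₁ N₂ D → (l :* N₁) :* (:1 :* D) :+ (:1 :* N₂) :* (:1 :* D)
                                   := D :* (l :* N₁ :+ :1 :* N₂)) ∼-refl
    bottom : ∀ N₁ N₂ D → (1ₚ ⊗ N₁) ⊗ (1ₚ ⊗ D) ⊕ (0ₚ ⊗ N₂) ⊗ (1ₚ ⊗ D) ≃ D ⊗ (1ₚ ⊗ N₁ ⊕ 0ₚ ⊗ N₂)
    bottom = solve 3 (λ N₁ N₂ D → (:1 :* N₁) :* (:1 :* D) :+ (:0 :* N₂) :* (:1 :* D)
                                   := D :* (:1 :* N₁ :+ :0 :* N₂)) ∼-refl
    denom : ∀ D → (1ₚ ⊗ D) ⊗ (1ₚ ⊗ D) ≃ D ⊗ (1ₚ ⊗ D)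
    denom = solve 1 (λ D → (:1 :* D) :* (:1 :* D) := D :* (:1 :* D)) ∼-refl

    column : ∀ {x₁ N₁ x₂ N₂ D} → Represents x₁ N₁ D → Represents x₂ N₂ D →
             Represents (topRow L x₁ x₂) (l ⊗ N₁ ⊕ 1ₚ ⊗ N₂) (1ₚ ⊗ D) ×
             Represents (bottomRow x₁ x₂) (1ₚ ⊗ N₁ ⊕ 0ₚ ⊗ N₂) (1ₚ ⊗ D)
    column {N₁ = N₁} {N₂ = N₂} {D} r₁ r₂ =
      topRow-represents {L = L} rL r₁ r₂ D _ _ (top l N₁ N₂ D) (denom D) ,
      bottomRow-represents r₁ r₂ D _ _ (bottom N₁ N₂ D) (denom D)

    acts′ : ∀ X N D → RepresentsM X N D →
            RepresentsM (foldr (_·Q_ K) X (map (Qprim K) (L ∷ []))) (mk l 1ₚ 1ₚ 0ₚ · N) (1ₚ ⊗ D)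
    acts′ (mat _ _ _ _) (mk _ _ _ _) D (r₁₁ , r₁₂ , r₂₁ , r₂₂) =
      proj₁ (column r₁₁ r₂₁) , proj₁ (column r₁₂ r₂₂) , proj₂ (column r₁₁ r₂₁) , proj₂ (column r₁₂ r₂₂)

  infixr 5 _⨾_
  _⨾_ : PrimProduct → PrimProduct → PrimProduct
  P ⨾ P′ = record
    { prims = prims P ++ prims P′ ; num = num P · num P′ ; den = den P ⊗ den P′ ; acts = acts′ }
    where
    acts′ : ∀ X N D → RepresentsM X N D →
            RepresentsM (foldr (_·Q_ K) X (map (Qprim K) (prims P ++ prims P′)))
                        ((num P · num P′) · N) ((den P ⊗ den P′) ⊗ D)
    acts′ X N D r rewrite List.map-++ (Qprim K) (prims P) (prims P′)
                        | List.foldr-++ (_·Q_ K) X (map (Qprim K) (prims P)) (map (Qprim K) (prims P′)) =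
      representsM-cong (·-assoc (num P) (num P′) N) (∼-sym (⊗-assoc (den P) (den P′) D))
        (acts P _ _ _ (acts P′ X N D r))

  length-⨾ : ∀ P P′ → length (prims (P ⨾ P′)) ≡ length (prims P) Data.Nat.+ length (prims P′)
  length-⨾ P P′ = List.length-++ (prims P)

  drop-vanishing : ∀ {a b z q} → a ≃ b ⊕ z ⊗ q → z ≃ 0ₚ → a ≃ b
  drop-vanishing {b = b} {q = q} a≃ z≃0 =
    ∼-trans a≃ (∼-trans (⊕-cong ∼-refl (⊗-cong z≃0 ∼-refl)) (absorb b q))
    where
    absorb : ∀ b q → b ⊕ 0ₚ ⊗ q ≃ b
    absorb = solve 2 (λ b q → b :+ :0 :* q := b) ∼-refl

  -- Three primitives giving a diagonal matrix:
  --   Q(r/d) · Q(s) · Q(r/d) = diag(r, s·d) / d   whenever r·s + d = 0,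
  -- since Q(a)Q(b)Q(a) = [[a(ab+2), ab+1], [ab+1, b]].
  diagonal : (L₁ L₂ : PALF K) (r d s : Pol) → Represents (⟦_⟧L K L₁) r d →
             Represents (⟦_⟧L K L₂) s 1ₚ → r ⊗ s ⊕ d ≃ 0ₚ → PrimProduct
  diagonal L₁ L₂ r d s rL₁ rL₂ rs+d≃0 = record
    { prims = L₁ ∷ L₂ ∷ L₁ ∷ [] ; num = mk r 0ₚ 0ₚ (s ⊗ d) ; den = d ; acts = acts′ }
    where
    top₁ : ∀ N₁ N₂ D → (r ⊗ N₁) ⊗ (1ₚ ⊗ D) ⊕ (1ₚ ⊗ N₂) ⊗ (d ⊗ D) ≃ D ⊗ (r ⊗ N₁ ⊕ d ⊗ N₂)
    top₁ N₁ N₂ D = solve 5 (λ r N₁ N₂ d D → (r :* N₁) :* (:1 :* D) :+ (:1 :* N₂) :* (d :* D)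
                                              := D :* (r :* N₁ :+ d :* N₂)) ∼-refl r N₁ N₂ d D
    den₁ : ∀ D → (d ⊗ D) ⊗ (1ₚ ⊗ D) ≃ D ⊗ (d ⊗ D)
    den₁ D = solve 2 (λ d D → (d :* D) :* (:1 :* D) := D :* (d :* D)) ∼-refl d D
    bottom₁ : ∀ N₁ N₂ D → (1ₚ ⊗ N₁) ⊗ (1ₚ ⊗ D) ⊕ (0ₚ ⊗ N₂) ⊗ (1ₚ ⊗ D) ≃ D ⊗ N₁
    bottom₁ = solve 3 (λ N₁ N₂ D → (:1 :* N₁) :* (:1 :* D) :+ (:0 :* N₂) :* (:1 :* D) := D :* N₁) ∼-refl
    bottomDen₁ : ∀ D → (1ₚ ⊗ D) ⊗ (1ₚ ⊗ D) ≃ D ⊗ D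
    bottomDen₁ = solve 1 (λ D → (:1 :* D) :* (:1 :* D) := D :* D) ∼-refl
    top₂ : ∀ Y N₁ D → (s ⊗ Y) ⊗ (1ₚ ⊗ D) ⊕ (1ₚ ⊗ N₁) ⊗ (1ₚ ⊗ (d ⊗ D)) ≃ D ⊗ (s ⊗ Y ⊕ d ⊗ N₁)
    top₂ Y N₁ D = solve 5 (λ s Y N₁ d D → (s :* Y) :* (:1 :* D) :+ (:1 :* N₁) :* (:1 :* (d :* D))
                                            := D :* (s :* Y :+ d :* N₁)) ∼-refl s Y N₁ d D
    den₂ : ∀ D → (1ₚ ⊗ (d ⊗ D)) ⊗ (1ₚ ⊗ D) ≃ D ⊗ (d ⊗ D)
    den₂ D = solve 2 (λ d D → (:1 :* (d :* D)) :* (:1 :* D) := D :* (d :* D)) ∼-refl d D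
    bottom₂ : ∀ Y N₁ D → (1ₚ ⊗ Y) ⊗ (1ₚ ⊗ D) ⊕ (0ₚ ⊗ N₁) ⊗ (1ₚ ⊗ (d ⊗ D)) ≃ D ⊗ Y
    bottom₂ Y N₁ D = solve 4 (λ Y N₁ d D → (:1 :* Y) :* (:1 :* D) :+ (:0 :* N₁) :* (:1 :* (d :* D))
                                             := D :* Y) ∼-refl Y N₁ d D
    top₃ : ∀ N₁ N₂ D →
      (r ⊗ (s ⊗ (r ⊗ N₁ ⊕ d ⊗ N₂) ⊕ d ⊗ N₁)) ⊗ (1ₚ ⊗ (d ⊗ D)) ⊕ (1ₚ ⊗ (r ⊗ N₁ ⊕ d ⊗ N₂)) ⊗ (d ⊗ (d ⊗ D))
        ≃ (d ⊗ (d ⊗ D)) ⊗ (r ⊗ N₁ ⊕ 0ₚ ⊗ N₂) ⊕ (r ⊗ s ⊕ d) ⊗ ((d ⊗ D) ⊗ (r ⊗ N₁ ⊕ d ⊗ N₂))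
    top₃ N₁ N₂ D = solve 6 (λ r s d N₁ N₂ D →
      (r :* (s :* (r :* N₁ :+ d :* N₂) :+ d :* N₁)) :* (:1 :* (d :* D)) :+ (:1 :* (r :* N₁ :+ d :* N₂)) :* (d :* (d :* D))
        := (d :* (d :* D)) :* (r :* N₁ :+ :0 :* N₂) :+ (r :* s :+ d) :* ((d :* D) :* (r :* N₁ :+ d :* N₂))) ∼-refl r s d N₁ N₂ D
    den₃ : ∀ D → (d ⊗ (d ⊗ D)) ⊗ (1ₚ ⊗ (d ⊗ D)) ≃ (d ⊗ (d ⊗ D)) ⊗ (d ⊗ D)
    den₃ D = solve 2 (λ d D → (d :* (d :* D)) :* (:1 :* (d :* D)) := (d :* (d :* D)) :* (d :* D)) ∼-refl d D
    bottom₃ : ∀ N₁ N₂ D →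
      (1ₚ ⊗ (s ⊗ (r ⊗ N₁ ⊕ d ⊗ N₂) ⊕ d ⊗ N₁)) ⊗ (1ₚ ⊗ (d ⊗ D)) ⊕ (0ₚ ⊗ (r ⊗ N₁ ⊕ d ⊗ N₂)) ⊗ (1ₚ ⊗ (d ⊗ D))
        ≃ (d ⊗ D) ⊗ (0ₚ ⊗ N₁ ⊕ (s ⊗ d) ⊗ N₂) ⊕ (r ⊗ s ⊕ d) ⊗ ((d ⊗ D) ⊗ N₁)
    bottom₃ N₁ N₂ D = solve 6 (λ r s d N₁ N₂ D →
      (:1 :* (s :* (r :* N₁ :+ d :* N₂) :+ d :* N₁)) :* (:1 :* (d :* D)) :+ (:0 :* (r :* N₁ :+ d :* N₂)) :* (:1 :* (d :* D))
        := (d :* D) :* (:0 :* N₁ :+ (s :* d) :* N₂) :+ (r :* s :+ d) :* ((d :* D) :* N₁)) ∼-refl r s d N₁ N₂ D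
    bottomDen₃ : ∀ D → (1ₚ ⊗ (d ⊗ D)) ⊗ (1ₚ ⊗ (d ⊗ D)) ≃ (d ⊗ D) ⊗ (d ⊗ D)
    bottomDen₃ D = solve 2 (λ d D → (:1 :* (d :* D)) :* (:1 :* (d :* D)) := (d :* D) :* (d :* D)) ∼-refl d D

    column : ∀ {x₁ x₂ N₁ N₂ D} → Represents x₁ N₁ D → Represents x₂ N₂ D →
      let y₁ = topRow L₁ x₁ x₂ ; y₂ = bottomRow x₁ x₂
          z₁ = topRow L₂ y₁ y₂ ; z₂ = bottomRow y₁ y₂ in
      Represents (topRow L₁ z₁ z₂) (r ⊗ N₁ ⊕ 0ₚ ⊗ N₂) (d ⊗ D) ×
      Represents (bottomRow z₁ z₂) (0ₚ ⊗ N₁ ⊕ (s ⊗ d) ⊗ N₂) (d ⊗ D)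
    column {N₁ = N₁} {N₂} {D} r₁ r₂ =
      topRow-represents {L = L₁} rL₁ rz₁ rz₂ (d ⊗ (d ⊗ D)) _ _
        (drop-vanishing (top₃ N₁ N₂ D) rs+d≃0) (den₃ D) ,
      bottomRow-represents rz₁ rz₂ (d ⊗ D) _ _ (drop-vanishing (bottom₃ N₁ N₂ D) rs+d≃0) (bottomDen₃ D)
      where
      Y = r ⊗ N₁ ⊕ d ⊗ N₂
      ry₁ = topRow-represents {L = L₁} rL₁ r₁ r₂ D Y (d ⊗ D) (top₁ N₁ N₂ D) (den₁ D)
      ry₂ = bottomRow-represents r₁ r₂ D N₁ D (bottom₁ N₁ N₂ D) (bottomDen₁ D)
      rz₁ = topRow-represents {L = L₂} rL₂ ry₁ ry₂ D (s ⊗ Y ⊕ d ⊗ N₁) (d ⊗ D) (top₂ Y N₁ D) (den₂ D)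
      rz₂ = bottomRow-represents ry₁ ry₂ D Y (d ⊗ D) (bottom₂ Y N₁ D) (den₂ D)

    acts′ : ∀ X N D → RepresentsM X N D →
            RepresentsM (foldr (_·Q_ K) X (map (Qprim K) (L₁ ∷ L₂ ∷ L₁ ∷ []))) (mk r 0ₚ 0ₚ (s ⊗ d) · N) (d ⊗ D)
    acts′ (mat _ _ _ _) (mk _ _ _ _) D (r₁₁ , r₁₂ , r₂₁ , r₂₂) =
      proj₁ (column r₁₁ r₂₁) , proj₁ (column r₁₂ r₂₂) , proj₂ (column r₁₁ r₂₁) , proj₂ (column r₁₂ r₂₂)

-- The ε-degree of polynomials: closure properties, and a bound evaluator
-- for polynomial expressions whose variables have degree a·p + b·δ.
module EpsilonDegree {c ℓ} (K : Field c ℓ) where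

  open import Level using (_⊔_)
  open import Data.Nat as ℕ using (ℕ; zero; suc; _+_; _*_; _≤_; z≤n; s≤s)
  import Data.Nat.Properties as ℕ
  open import Data.Nat.Tactic.RingSolver using (solve-∀)
  open import Data.Fin using (Fin)
  open import Data.Vec using (Vec; lookup)
  open import Data.Vec.Relation.Unary.All using (All)
  open import Data.Vec.Relation.Unary.All.Properties using (lookup⁺)
  open import Relation.Nullary.Decidable using (True; toWitness)
  open import Data.Product using (_×_; _,_; proj₁; proj₂)
  open import Relation.Binary.PropositionalEquality as ≡ using (_≡_)
  open Field K using (0#; 1#)
  open TermRing K

  Deg≤ : ℕ → Pol → Set (c ⊔ ℓ)
  Deg≤ = EpsDeg≤ K

  deg-cong : ∀ {k t t'} → t ≃ t' → Deg≤ k t → Deg≤ k t'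
  deg-cong {zero}  t≃t' (p , free , t≃p)         = p , free , ∼-trans (∼-sym t≃t') t≃p
  deg-cong {suc k} t≃t' (p , r , free , dr , t≃) = p , r , free , dr , ∼-trans (∼-sym t≃t') t≃

  deg-free : ∀ {p} → EpsFree K p → Deg≤ 0 p
  deg-free {p} free = p , free , ∼-refl

  deg-0ₚ : ∀ {k} → Deg≤ k 0ₚ
  deg-0ₚ {zero}  = deg-free (const 0#)
  deg-0ₚ {suc k} = 0ₚ , 0ₚ , const 0# , deg-0ₚ , ∼-sym (∼-trans (⊕-idˡ _) (zeroʳ eps))

  deg-mono : ∀ {k k' t} → k ≤ k' → Deg≤ k t → Deg≤ k' t
  deg-mono {k' = zero}   z≤n d                            = d
  deg-mono {k' = suc k'} z≤n (p , free , t≃p)             =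
    p , 0ₚ , free , deg-0ₚ , ∼-trans t≃p (∼-sym (∼-trans (⊕-cong ∼-refl (zeroʳ eps)) (+-identityʳ p)))
  deg-mono (s≤s k≤k') (p , r , free , dr , t≃) = p , r , free , deg-mono k≤k' dr , t≃

  deg-⊕ : ∀ {k a b} → Deg≤ k a → Deg≤ k b → Deg≤ k (a ⊕ b)
  deg-⊕ {zero} (p₁ , f₁ , e₁) (p₂ , f₂ , e₂) = p₁ ⊕ p₂ , f₁ ⊕ f₂ , ⊕-cong e₁ e₂
  deg-⊕ {suc k} (p₁ , r₁ , f₁ , d₁ , e₁) (p₂ , r₂ , f₂ , d₂ , e₂) =
    p₁ ⊕ p₂ , r₁ ⊕ r₂ , f₁ ⊕ f₂ , deg-⊕ d₁ d₂ , ∼-trans (⊕-cong e₁ e₂) (regroup p₁ r₁ p₂ r₂ eps)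
    where
    regroup : ∀ p₁ r₁ p₂ r₂ e → (p₁ ⊕ e ⊗ r₁) ⊕ (p₂ ⊕ e ⊗ r₂) ≃ (p₁ ⊕ p₂) ⊕ e ⊗ (r₁ ⊕ r₂)
    regroup = solve 5 (λ p₁ r₁ p₂ r₂ e → (p₁ :+ e :* r₁) :+ (p₂ :+ e :* r₂)
                                          := (p₁ :+ p₂) :+ e :* (r₁ :+ r₂)) ∼-refl

  deg-⊖ : ∀ {k a} → Deg≤ k a → Deg≤ k (⊖ a)
  deg-⊖ {zero}  (p , f , e)         = ⊖ p , ⊖ f , ⊖-cong e
  deg-⊖ {suc k} (p , r , f , d , e) = ⊖ p , ⊖ r , ⊖ f , deg-⊖ d , ∼-trans (⊖-cong e) (negate p r eps)
    where
    negate : ∀ p r e → ⊖ (p ⊕ e ⊗ r) ≃ ⊖ p ⊕ e ⊗ ⊖ r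
    negate = solve 3 (λ p r e → :- (p :+ e :* r) := :- p :+ e :* :- r) ∼-refl

  deg-scale : ∀ {k q y} → EpsFree K q → Deg≤ k y → Deg≤ k (q ⊗ y)
  deg-scale {zero}  {q} fq (p , fp , e) = q ⊗ p , fq ⊗ fp , ⊗-cong ∼-refl e
  deg-scale {suc k} {q} fq (p , r , fp , dr , e) =
    q ⊗ p , q ⊗ r , fq ⊗ fp , deg-scale fq dr , ∼-trans (⊗-cong ∼-refl e) (expand q p r eps)
    where
    expand : ∀ q p r e → q ⊗ (p ⊕ e ⊗ r) ≃ q ⊗ p ⊕ e ⊗ (q ⊗ r)
    expand = solve 4 (λ q p r e → q :* (p :+ e :* r) := q :* p :+ e :* (q :* r)) ∼-refl

  deg-⊗ : ∀ {a b x y} → Deg≤ a x → Deg≤ b y → Deg≤ (a + b) (x ⊗ y)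
  deg-⊗ {zero} (p , fp , e) dy = deg-cong (⊗-cong (∼-sym e) ∼-refl) (deg-scale fp dy)
  deg-⊗ {suc a} {b} {y = y} (p , r , fp , dr , e) dy
    with deg-mono {k' = suc (a + b)} (ℕ.≤-trans (ℕ.m≤n+m b a) (ℕ.n≤1+n _)) (deg-scale fp dy)
  ... | (p′ , r′ , fp′ , dr′ , e′) =
    p′ , r′ ⊕ r ⊗ y , fp′ , deg-⊕ dr′ (deg-⊗ dr dy) ,
    ∼-trans (⊗-cong e ∼-refl) (∼-trans (expand p r eps y) (∼-trans (⊕-cong e′ ∼-refl) (regroup p′ r′ eps _)))
    where
    expand : ∀ p r e y → (p ⊕ e ⊗ r) ⊗ y ≃ p ⊗ y ⊕ e ⊗ (r ⊗ y)
    expand = solve 4 (λ p r e y → (p :+ e :* r) :* y := p :* y :+ e :* (r :* y)) ∼-refl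
    regroup : ∀ p r e B → (p ⊕ e ⊗ r) ⊕ e ⊗ B ≃ p ⊕ e ⊗ (r ⊕ B)
    regroup = solve 4 (λ p r e B → (p :+ e :* r) :+ e :* B := p :+ e :* (r :+ B)) ∼-refl

  ε^_ : ℕ → Pol
  ε^ zero  = 1ₚ
  ε^ suc n = eps ⊗ ε^ n

  ε^-epsOnly : ∀ n → EpsOnly K (ε^ n)
  ε^-epsOnly zero    = const 1#
  ε^-epsOnly (suc n) = eps ⊗ ε^-epsOnly n

  ε^-+ : ∀ m n → ε^ (m + n) ≃ ε^ m ⊗ ε^ n
  ε^-+ zero    n = ∼-sym (⊗-idˡ _)
  ε^-+ (suc m) n = ∼-trans (⊗-cong ∼-refl (ε^-+ m n)) (∼-sym (⊗-assoc _ _ _))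

  deg-ε^ : ∀ n → Deg≤ n (ε^ n)
  deg-ε^ zero    = deg-free (const 1#)
  deg-ε^ (suc n) = 0ₚ , ε^ n , const 0# , deg-ε^ n , ∼-sym (⊕-idˡ _)

  -- A weight (a , b) stands for the degree
  -- bound a·p + b·δ; sums take the maximum and products the sum of
  -- weights, so the weight of an expression is computed syntactically
  -- and compared with a target weight by normalisation.

  data DegExpr (n : ℕ) : Set where
    var′       : Fin n → DegExpr n
    zero′ one′ : DegExpr n
    _+′_ _*′_  : DegExpr n → DegExpr n → DegExpr n
    -′_        : DegExpr n → DegExpr n

  degOps : ∀ {n} → RingOps (DegExpr n)
  degOps = record { _⊞_ = _+′_ ; _⊠_ = _*′_ ; ⊟_ = -′_ ; zer = zero′ ; one = one′ }

  Weight : Set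
  Weight = ℕ × ℕ

  Valuation : ℕ → Set c
  Valuation n = Vec (Pol × Weight) n

  ⟦_⟧ : ∀ {n} → DegExpr n → Valuation n → Pol
  ⟦ var′ i ⟧ ρ = proj₁ (lookup ρ i)
  ⟦ zero′  ⟧ ρ = 0ₚ
  ⟦ one′   ⟧ ρ = 1ₚ
  ⟦ a +′ b ⟧ ρ = ⟦ a ⟧ ρ ⊕ ⟦ b ⟧ ρ
  ⟦ a *′ b ⟧ ρ = ⟦ a ⟧ ρ ⊗ ⟦ b ⟧ ρ
  ⟦ -′ a   ⟧ ρ = ⊖ ⟦ a ⟧ ρ

  weightOf : ∀ {n} → DegExpr n → Valuation n → Weight
  weightOf (var′ i) ρ = proj₂ (lookup ρ i)
  weightOf zero′    ρ = 0 , 0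
  weightOf one′     ρ = 0 , 0
  weightOf (a +′ b) ρ = proj₁ (weightOf a ρ) ℕ.⊔ proj₁ (weightOf b ρ) , proj₂ (weightOf a ρ) ℕ.⊔ proj₂ (weightOf b ρ)
  weightOf (a *′ b) ρ = proj₁ (weightOf a ρ) + proj₁ (weightOf b ρ) , proj₂ (weightOf a ρ) + proj₂ (weightOf b ρ)
  weightOf (-′ a)   ρ = weightOf a ρ

  module WeightedDegree (p δ : ℕ) where

    ⟪_⟫ : Weight → ℕ
    ⟪ a , b ⟫ = a * p + b * δ

    ⟪⟫-mono : ∀ w w' → proj₁ w ≤ proj₁ w' → proj₂ w ≤ proj₂ w' → ⟪ w ⟫ ≤ ⟪ w' ⟫
    ⟪⟫-mono _ _ a≤a' b≤b' = ℕ.+-mono-≤ (ℕ.*-monoˡ-≤ p a≤a') (ℕ.*-monoˡ-≤ δ b≤b')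

    ⟪⟫-+ : ∀ a b a' b' → ⟪ a + a' , b + b' ⟫ ≡ ⟪ a , b ⟫ + ⟪ a' , b' ⟫
    ⟪⟫-+ a b a' b' = additive a a' b b' p δ
      where
      additive : ∀ a a' b b' p δ → (a + a') * p + (b + b') * δ ≡ (a * p + b * δ) + (a' * p + b' * δ)
      additive = solve-∀

    Admissible : ∀ {n} → Valuation n → Set (c ⊔ ℓ)
    Admissible = All (λ { (x , w) → Deg≤ ⟪ w ⟫ x })

    weightOf-sound : ∀ {n} {ρ : Valuation n} → Admissible ρ → ∀ e → Deg≤ ⟪ weightOf e ρ ⟫ (⟦ e ⟧ ρ)
    weightOf-sound adm (var′ i) = lookup⁺ adm i
    weightOf-sound adm zero′    = deg-free (const 0#)
    weightOf-sound adm one′     = deg-free (const 1#)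
    weightOf-sound {ρ = ρ} adm (a +′ b) =
      deg-⊕ (deg-mono (⟪⟫-mono (weightOf a ρ) (weightOf (a +′ b) ρ) (ℕ.m≤m⊔n _ _) (ℕ.m≤m⊔n _ _)) (weightOf-sound adm a))
            (deg-mono (⟪⟫-mono (weightOf b ρ) (weightOf (a +′ b) ρ) (ℕ.m≤n⊔m _ _) (ℕ.m≤n⊔m _ _)) (weightOf-sound adm b))
    weightOf-sound {ρ = ρ} adm (a *′ b) =
      ≡.subst (λ k → Deg≤ k (⟦ a ⟧ ρ ⊗ ⟦ b ⟧ ρ))
        (≡.sym (⟪⟫-+ (proj₁ (weightOf a ρ)) (proj₂ (weightOf a ρ)) (proj₁ (weightOf b ρ)) (proj₂ (weightOf b ρ))))
        (deg-⊗ (weightOf-sound adm a) (weightOf-sound adm b))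
    weightOf-sound adm (-′ a) = deg-⊖ (weightOf-sound adm a)

    -- the form in which the bound is used: the weight comparison is
    -- decided by computation
    deg-by-weight : ∀ {n} {ρ : Valuation n} → Admissible ρ → ∀ e a b →
      True (proj₁ (weightOf e ρ) ℕ.≤? a) → True (proj₂ (weightOf e ρ) ℕ.≤? b) →
      Deg≤ ⟪ a , b ⟫ (⟦ e ⟧ ρ)
    deg-by-weight {ρ = ρ} adm e a b w₁ w₂ =
      deg-mono (⟪⟫-mono (weightOf e ρ) (a , b) (toWitness w₁) (toWitness w₂)) (weightOf-sound adm e)

-- Approximations of Q(h) by products of primitive Q-matrices, and the
-- gadgets combining them.
module Approximations {c ℓ} (K : Field c ℓ) where

  open import Level using (_⊔_)
  open import Data.Nat as ℕ using (ℕ; zero; suc; _+_; _*_; _≤_; z≤n)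
  import Data.Nat.Properties as ℕ
  open import Data.Fin using (#_)
  open import Data.Vec using (_∷_; [])
  open import Data.Vec.N-ary using (N-ary)
  open import Data.Vec.Relation.Unary.All using (_∷_; [])
  open import Data.Product using (_×_; _,_; proj₁; proj₂)
  open import Data.List using ([]; _∷_; length; map)
  open import Data.Nat.Tactic.RingSolver using (solve-∀)
  open import Relation.Nullary.Decidable using (True)
  open import Relation.Binary.PropositionalEquality as ≡ using (_≡_)
  open import Relation.Nullary using (¬_)
  open PrimitiveProducts K public
  open EpsilonDegree K public
  private module Fld = Field K
  open Fld using (0#; 1#; 1≉0) renaming (Carrier to 𝔽)

  -- Denominators are nonzero: evaluating at x = 0, ε = e is compatible
  -- with ∼, and 1 ≠ 0 in 𝔽.

  evalAt : 𝔽 → Pol → 𝔽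
  evalAt e (const a) = a
  evalAt e eps       = e
  evalAt e (var _)   = 0#
  evalAt e (a ⊕ b)   = evalAt e a Fld.+ evalAt e b
  evalAt e (a ⊗ b)   = evalAt e a Fld.* evalAt e b
  evalAt e (⊖ a)     = Fld.- evalAt e a

  evalAt-sound : ∀ e {a b} → a ≃ b → evalAt e a Fld.≈ evalAt e b
  evalAt-sound e ∼-refl             = Fld.refl
  evalAt-sound e (∼-sym h)          = Fld.sym (evalAt-sound e h)
  evalAt-sound e (∼-trans h h')     = Fld.trans (evalAt-sound e h) (evalAt-sound e h')
  evalAt-sound e (⊕-cong h h')      = Fld.+-cong (evalAt-sound e h) (evalAt-sound e h')
  evalAt-sound e (⊗-cong h h')      = Fld.*-cong (evalAt-sound e h) (evalAt-sound e h')
  evalAt-sound e (⊖-cong h)         = Fld.-‿cong (evalAt-sound e h)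
  evalAt-sound e (⊕-assoc _ _ _)    = Fld.+-assoc _ _ _
  evalAt-sound e (⊕-comm _ _)       = Fld.+-comm _ _
  evalAt-sound e (⊕-idˡ _)          = Fld.+-identityˡ _
  evalAt-sound e (⊖-invˡ _)         = Fld.-‿inverseˡ _
  evalAt-sound e (⊗-assoc _ _ _)    = Fld.*-assoc _ _ _
  evalAt-sound e (⊗-comm _ _)       = Fld.*-comm _ _
  evalAt-sound e (⊗-idˡ _)          = Fld.*-identityˡ _
  evalAt-sound e (distribˡ _ _ _)   = Fld.distribˡ _ _ _
  evalAt-sound e (const-cong h)     = h
  evalAt-sound e (const-+ _ _)      = Fld.refl
  evalAt-sound e (const-* _ _)      = Fld.refl
  evalAt-sound e (const-- _)        = Fld.refl

  1ₚ≄0ₚ : ¬ (1ₚ ≃ 0ₚ)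
  1ₚ≄0ₚ h = 1≉0 (evalAt-sound 0# h)

  ε^≄0ₚ : ∀ n → ¬ (ε^ n ≃ 0ₚ)
  ε^≄0ₚ n h = 1≉0 (Fld.trans (Fld.sym (at1 n)) (evalAt-sound 1# h))
    where
    at1 : ∀ n → evalAt 1# (ε^ n) Fld.≈ 1#
    at1 zero    = Fld.refl
    at1 (suc n) = Fld.trans (Fld.*-identityˡ _) (at1 n)

  polyCoeff : (n : Pol) → EpsOnly K n → Coeff K
  polyCoeff n ok = n / 1ₚ ∣ ok , const 1# , 1ₚ≄0ₚ

  coeffOverε^ : ℕ → (n : Pol) → EpsOnly K n → Coeff K
  coeffOverε^ p n ok = n / ε^ p ∣ ok , ε^-epsOnly p , ε^≄0ₚ p

  constForm : Coeff K → PALF K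
  constForm k = record { constTerm = k ; linTerms = [] }

  constForm-represents : ∀ k → Represents (⟦_⟧L K (constForm k)) (Coeff.num k) (Coeff.den k)
  constForm-represents k = represents-pair _ _

  varForm : 𝔽 → ℕ → PALF K
  varForm α i = record
    { constTerm = polyCoeff 0ₚ (const 0#) ; linTerms = (i , polyCoeff (const α) (const α)) ∷ [] }

  varForm-represents : ∀ α i → Represents (⟦_⟧L K (varForm α i)) (const α ⊗ var i) 1ₚ
  varForm-represents α i =
    represents-cong (simplify (const α) (var i)) (solve 0 ((:1 :* :1) :* :1 := :1) ∼-refl)
      (represents-+ (represents-* (represents-pair (const α) 1ₚ) (represents-ι (var i))) (represents-pair 0ₚ 1ₚ))
    where
    simplify : ∀ a x → (a ⊗ x) ⊗ 1ₚ ⊕ 0ₚ ⊗ (1ₚ ⊗ 1ₚ) ≃ a ⊗ x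
    simplify = solve 2 (λ a x → (a :* x) :* :1 :+ :0 :* (:1 :* :1) := a :* x) ∼-refl

  solverOps : ∀ {n} → RingOps (Polynomial n)
  solverOps = record { _⊞_ = _:+_ ; _⊠_ = _:*_ ; ⊟_ = :-_ ; zer = :0 ; one = :1 }

  module Syntactic {n} = MatrixOps (solverOps {n})

  sumEquation squareEquation :
    (M2 (Polynomial 13) → Polynomial 13) → N-ary 13 (Polynomial 13) (Polynomial 13 × Polynomial 13)
  sumEquation entry DA DB a b t e₁ e₂ e₃ e₄ f₁ f₂ f₃ f₄ =
    entry (Syntactic.sumLHS DA DB a b t (mk e₁ e₂ e₃ e₄) (mk f₁ f₂ f₃ f₄))
      := entry (Syntactic.sumRHS DA DB a b t (mk e₁ e₂ e₃ e₄) (mk f₁ f₂ f₃ f₄))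
  squareEquation entry DA DB t h l e₁ e₂ e₃ e₄ f₁ f₂ f₃ f₄ =
    entry (Syntactic.squareLHS DA DB t h l (mk e₁ e₂ e₃ e₄) (mk f₁ f₂ f₃ f₄))
      := entry (Syntactic.squareRHS DA DB t h l (mk e₁ e₂ e₃ e₄) (mk f₁ f₂ f₃ f₄))

  sumIdentity : ∀ DA DB a b t E F → sumLHS DA DB a b t E F ≈ₘ sumRHS DA DB a b t E F
  sumIdentity DA DB a b t (mk e₁ e₂ e₃ e₄) (mk f₁ f₂ f₃ f₄) =
    solve 13 (sumEquation M2.e₁₁) ∼-refl DA DB a b t e₁ e₂ e₃ e₄ f₁ f₂ f₃ f₄ ,
    solve 13 (sumEquation M2.e₁₂) ∼-refl DA DB a b t e₁ e₂ e₃ e₄ f₁ f₂ f₃ f₄ ,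
    solve 13 (sumEquation M2.e₂₁) ∼-refl DA DB a b t e₁ e₂ e₃ e₄ f₁ f₂ f₃ f₄ ,
    solve 13 (sumEquation M2.e₂₂) ∼-refl DA DB a b t e₁ e₂ e₃ e₄ f₁ f₂ f₃ f₄

  squareIdentity : ∀ DA DB t h l E F → squareLHS DA DB t h l E F ≈ₘ squareRHS DA DB t h l E F
  squareIdentity DA DB t h l (mk e₁ e₂ e₃ e₄) (mk f₁ f₂ f₃ f₄) =
    solve 13 (squareEquation M2.e₁₁) ∼-refl DA DB t h l e₁ e₂ e₃ e₄ f₁ f₂ f₃ f₄ ,
    solve 13 (squareEquation M2.e₁₂) ∼-refl DA DB t h l e₁ e₂ e₃ e₄ f₁ f₂ f₃ f₄ ,
    solve 13 (squareEquation M2.e₂₁) ∼-refl DA DB t h l e₁ e₂ e₃ e₄ f₁ f₂ f₃ f₄ ,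
    solve 13 (squareEquation M2.e₂₂) ∼-refl DA DB t h l e₁ e₂ e₃ e₄ f₁ f₂ f₃ f₄

  MatDeg≤ : ℕ → PMat → Set (c ⊔ ℓ)
  MatDeg≤ k (mk a b e f) = Deg≤ k a × Deg≤ k b × Deg≤ k e × Deg≤ k f

  record Approximation (h : Pol) (p δ s : ℕ) : Set (c ⊔ ℓ) where
    field
      product   : PrimProduct
      length≤   : length (prims product) ≤ s
      error     : PMat
      num≈      : num product ≈ₘ scale (den product) (perturbedQ h (ε^ p) error)
      error-deg : MatDeg≤ δ error
  open Approximation public

  scale-cong : ∀ {D A A'} → A ≈ₘ A' → scale D A ≈ₘ scale D A'
  scale-cong {A = mk _ _ _ _} {mk _ _ _ _} (a , b , e , f) =
    ⊗-cong ∼-refl a , ⊗-cong ∼-refl b , ⊗-cong ∼-refl e , ⊗-cong ∼-refl f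

  perturbedQ-cong : ∀ {h h' t t' E} → h ≃ h' → t ≃ t' → perturbedQ h t E ≈ₘ perturbedQ h' t' E
  perturbedQ-cong {E = mk _ _ _ _} h≃h' t≃t' =
    ⊕-cong h≃h' (⊗-cong t≃t' ∼-refl) , ⊕-cong ∼-refl (⊗-cong t≃t' ∼-refl) ,
    ⊕-cong ∼-refl (⊗-cong t≃t' ∼-refl) , ⊕-cong ∼-refl (⊗-cong t≃t' ∼-refl)

  approximation-cong : ∀ {h h' p δ s} → h ≃ h' → Approximation h p δ s → Approximation h' p δ s
  approximation-cong h≃h' A = record
    { product = product A ; length≤ = length≤ A ; error = error A
    ; num≈ = ≈ₘ-trans (num≈ A) (scale-cong (perturbedQ-cong h≃h' ∼-refl)) ; error-deg = error-deg A }

  approximation-weaken : ∀ {h p δ δ' s s'} → δ ≤ δ' → s ≤ s' → Approximation h p δ s → Approximation h p δ' s'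
  approximation-weaken δ≤δ' s≤s' A = record
    { product = product A ; length≤ = ℕ.≤-trans (length≤ A) s≤s' ; error = error A ; num≈ = num≈ A
    ; error-deg = weaken (error A) (error-deg A) }
    where
    weaken : ∀ E → MatDeg≤ _ E → MatDeg≤ _ E
    weaken (mk _ _ _ _) (a , b , e , f) = deg-mono δ≤δ' a , deg-mono δ≤δ' b , deg-mono δ≤δ' e , deg-mono δ≤δ' f

  approximation-leaf : ∀ p (L : PALF K) l → Represents (⟦_⟧L K L) l 1ₚ → Approximation l p 0 1
  approximation-leaf p L l rL = record
    { product = single L l rL ; length≤ = ℕ.≤-refl ; error = mk 0ₚ 0ₚ 0ₚ 0ₚ
    ; num≈ = exact l (ε^ p) , exact 1ₚ (ε^ p) , exact 1ₚ (ε^ p) , exact 0ₚ (ε^ p)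
    ; error-deg = deg-0ₚ {0} , deg-0ₚ {0} , deg-0ₚ {0} , deg-0ₚ {0} }
    where
    exact : ∀ a t → a ≃ 1ₚ ⊗ (a ⊕ t ⊗ 0ₚ)
    exact = solve 2 (λ a t → a := :1 :* (a :+ t :* :0)) ∼-refl

  -- Error bounds for the gadgets: the error matrices of the two factors
  -- have weight (0,1), the perturbation ε^p has weight (1,0), and the
  -- ε-free polynomials weight (0,0).

  gadgetValuation : Pol → Pol → Pol → PMat → PMat → Valuation 11
  gadgetValuation t a b E F =
    (t , 1 , 0) ∷ (a , 0 , 0) ∷ (b , 0 , 0) ∷
    (M2.e₁₁ E , 0 , 1) ∷ (M2.e₁₂ E , 0 , 1) ∷ (M2.e₂₁ E , 0 , 1) ∷ (M2.e₂₂ E , 0 , 1) ∷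
    (M2.e₁₁ F , 0 , 1) ∷ (M2.e₁₂ F , 0 , 1) ∷ (M2.e₂₁ F , 0 , 1) ∷ (M2.e₂₂ F , 0 , 1) ∷ []

  module Symbolic = MatrixOps (degOps {11})

  tᵥ aᵥ bᵥ : DegExpr 11
  tᵥ = var′ (# 0)
  aᵥ = var′ (# 1)
  bᵥ = var′ (# 2)
  Eᵥ Fᵥ : M2 (DegExpr 11)
  Eᵥ = mk (var′ (# 3)) (var′ (# 4)) (var′ (# 5)) (var′ (# 6))
  Fᵥ = mk (var′ (# 7)) (var′ (# 8)) (var′ (# 9)) (var′ (# 10))

  module Bounds (p δ : ℕ) where
    open WeightedDegree p δ public

    gadgetValuation-admissible : ∀ {a b E F} → EpsFree K a → EpsFree K b → MatDeg≤ δ E → MatDeg≤ δ F →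
      Admissible (gadgetValuation (ε^ p) a b E F)
    gadgetValuation-admissible {E = mk _ _ _ _} {mk _ _ _ _} fa fb (e₁ , e₂ , e₃ , e₄) (f₁ , f₂ , f₃ , f₄) =
      ≡.subst (λ k → Deg≤ k (ε^ p)) (unitWeight p δ) (deg-ε^ p) ∷ deg-free fa ∷ deg-free fb ∷
      err e₁ ∷ err e₂ ∷ err e₃ ∷ err e₄ ∷ err f₁ ∷ err f₂ ∷ err f₃ ∷ err f₄ ∷ []
      where
      unitWeight : ∀ p δ → p ≡ 1 * p + 0 * δ
      unitWeight = solve-∀
      err : ∀ {x} → Deg≤ δ x → Deg≤ ⟪ 0 , 1 ⟫ x
      err {x} = ≡.subst (λ k → Deg≤ k x) (≡.sym (ℕ.+-identityʳ δ))

    matDeg-by-weight : ∀ {n} {ρ : Valuation n} → Admissible ρ → (E : M2 (DegExpr n)) → ∀ a b →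
      let w = λ e → weightOf e ρ in
      {_ : True (proj₁ (w (M2.e₁₁ E)) ℕ.≤? a)} {_ : True (proj₂ (w (M2.e₁₁ E)) ℕ.≤? b)}
      {_ : True (proj₁ (w (M2.e₁₂ E)) ℕ.≤? a)} {_ : True (proj₂ (w (M2.e₁₂ E)) ℕ.≤? b)}
      {_ : True (proj₁ (w (M2.e₂₁ E)) ℕ.≤? a)} {_ : True (proj₂ (w (M2.e₂₁ E)) ℕ.≤? b)}
      {_ : True (proj₁ (w (M2.e₂₂ E)) ℕ.≤? a)} {_ : True (proj₂ (w (M2.e₂₂ E)) ℕ.≤? b)} →
      MatDeg≤ ⟪ a , b ⟫ (mk (⟦ M2.e₁₁ E ⟧ ρ) (⟦ M2.e₁₂ E ⟧ ρ) (⟦ M2.e₂₁ E ⟧ ρ) (⟦ M2.e₂₂ E ⟧ ρ))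
    matDeg-by-weight adm (mk e₁ e₂ e₃ e₄) a b {w₁} {w₁'} {w₂} {w₂'} {w₃} {w₃'} {w₄} {w₄'} =
      deg-by-weight adm e₁ a b w₁ w₁' , deg-by-weight adm e₂ a b w₂ w₂' ,
      deg-by-weight adm e₃ a b w₃ w₃' , deg-by-weight adm e₄ a b w₄ w₄'

  approximation-sum : ∀ {a b p δ s₁ s₂} → EpsFree K a → EpsFree K b →
    Approximation a p δ s₁ → Approximation b p δ s₂ →
    Approximation (a ⊕ b) p (1 * p + 2 * δ) (s₁ + (1 + s₂))
  approximation-sum {a} {b} {p} {δ} {s₁} {s₂} fa fb A B = record
    { product = P
    ; length≤ = ≡.subst (_≤ s₁ + (1 + s₂)) (≡.sym length-P)
                        (ℕ.+-mono-≤ (length≤ A) (ℕ.+-monoʳ-≤ 1 (length≤ B)))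
    ; error = sumError a b t (error A) (error B)
    ; num≈ = ≈ₘ-trans (·-cong (num≈ A) (·-cong (≈ₘ-refl {mk 0ₚ 1ₚ 1ₚ 0ₚ}) (num≈ B)))
                      (sumIdentity (den (product A)) (den (product B)) a b t (error A) (error B))
    ; error-deg = matDeg-by-weight admissible (Symbolic.sumError aᵥ bᵥ tᵥ Eᵥ Fᵥ) 1 2 }
    where
    open Bounds p δ
    t = ε^ p
    0/1 = polyCoeff 0ₚ (const 0#)
    Q₀ = single (constForm 0/1) 0ₚ (constForm-represents 0/1)
    P = product A ⨾ Q₀ ⨾ product B
    length-P : length (prims P) ≡ length (prims (product A)) + (1 + length (prims (product B)))
    length-P = ≡.trans (length-⨾ (product A) (Q₀ ⨾ product B))
                       (≡.cong (_+_ (length (prims (product A)))) (length-⨾ Q₀ (product B)))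
    admissible = gadgetValuation-admissible fa fb (error-deg A) (error-deg B)

  -- Squaring (t = ε^p, inner approximations to precision t³ = ε^{3p}):
  --   diag(-1, t²)/t · Q(h + t³E) · Q(λt²) · Q(-h + t³F) · diag(1, -t²)/t
  --     = Q(λh²) + t·E',
  -- where the diagonal factors come from `diagonal` with r/d = ∓1/t.

  approximation-square : ∀ {h h' p δ s₁ s₂} (λ′ : 𝔽) → EpsFree K h → h' ≃ ⊖ h →
    Approximation h (3 * p) δ s₁ → Approximation h' (3 * p) δ s₂ →
    Approximation (const λ′ ⊗ (h ⊗ h)) p (9 * p + 2 * δ) (3 + (s₁ + (1 + (s₂ + 3))))
  approximation-square {h} {h'} {p} {δ} {s₁} {s₂} λ′ fh h'≃-h A B = record
    { product = P
    ; length≤ = ≡.subst (_≤ 3 + (s₁ + (1 + (s₂ + 3)))) (≡.sym length-P)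
                  (ℕ.+-monoʳ-≤ 3 (ℕ.+-mono-≤ (length≤ A) (ℕ.+-monoʳ-≤ 1 (ℕ.+-monoˡ-≤ 3 (length≤ B)))))
    ; error = squareError t h l (error A) (error B)
    ; num≈ = ≈ₘ-trans (·-cong (≈ₘ-refl {num W₁}) (·-cong numA
                        (·-cong (≈ₘ-refl {num Qλ}) (·-cong numB (≈ₘ-refl {num W₂})))))
                      (squareIdentity (den (product A)) (den (product B)) t h l (error A) (error B))
    ; error-deg = matDeg-by-weight admissible (Symbolic.squareError tᵥ aᵥ bᵥ Eᵥ Fᵥ) 9 2 }
    where
    open Bounds p δ
    t = ε^ p
    l = const λ′
    -- diag(-1, t²)/t = Q(-1/t)Q(t)Q(-1/t),  diag(1, -t²)/t = Q(1/t)Q(-t)Q(1/t),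
    -- and the middle factor Q(λt²)
    -1/t 1/t t′ -t′ λt² : Coeff K
    -1/t = coeffOverε^ p (⊖ 1ₚ) (⊖ const 1#)
    1/t  = coeffOverε^ p 1ₚ (const 1#)
    t′   = polyCoeff t (ε^-epsOnly p)
    -t′  = polyCoeff (⊖ t) (⊖ ε^-epsOnly p)
    λt²  = polyCoeff (l ⊗ (t ⊗ t)) (const λ′ ⊗ (ε^-epsOnly p ⊗ ε^-epsOnly p))
    W₁ = diagonal (constForm -1/t) (constForm t′) (⊖ 1ₚ) t t
                  (constForm-represents -1/t) (constForm-represents t′)
                  (solve 1 (λ t → :- :1 :* t :+ t := :0) ∼-refl t)
    W₂ = diagonal (constForm 1/t) (constForm -t′) 1ₚ t (⊖ t)
                  (constForm-represents 1/t) (constForm-represents -t′)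
                  (solve 1 (λ t → :1 :* :- t :+ t := :0) ∼-refl t)
    Qλ = single (constForm λt²) (l ⊗ (t ⊗ t)) (constForm-represents λt²)
    P = W₁ ⨾ product A ⨾ Qλ ⨾ product B ⨾ W₂
    length-P : length (prims P) ≡ 3 + (length (prims (product A)) + (1 + (length (prims (product B)) + 3)))
    length-P =
      ≡.trans (length-⨾ W₁ (product A ⨾ Qλ ⨾ product B ⨾ W₂))
        (≡.cong (_+_ 3) (≡.trans (length-⨾ (product A) (Qλ ⨾ product B ⨾ W₂))
        (≡.cong (_+_ (length (prims (product A)))) (≡.trans (length-⨾ Qλ (product B ⨾ W₂))
          (≡.cong (_+_ 1) (length-⨾ (product B) W₂))))))
    t³ : ε^ (3 * p) ≃ t ⊗ (t ⊗ t)
    t³ = ∼-trans (ε^-+ p _) (⊗-cong ∼-refl (∼-trans (ε^-+ p _)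
           (⊗-cong ∼-refl (≡⇒≃ (≡.cong ε^_ (ℕ.+-identityʳ p))))))
    numA = ≈ₘ-trans (num≈ A) (scale-cong (perturbedQ-cong ∼-refl t³))
    numB = ≈ₘ-trans (num≈ B) (scale-cong (perturbedQ-cong h'≃-h t³))
    admissible = gadgetValuation-admissible fh (const λ′) (error-deg A) (error-deg B)

  asMat2 : PMat → Mat2 K Pol
  asMat2 (mk a b e f) = mat a b e f

  identity : PMat
  identity = mk 1ₚ 0ₚ 0ₚ 1ₚ

  approximation-product : ∀ {h p δ s} (A : Approximation h p δ s) →
    _≈M_ K (prodQ K (map (Qprim K) (prims (product A)))) (embed K (asMat2 (perturbedQ h (ε^ p) (error A))))
  approximation-product {h} {p} A
    with acts (product A) (I₂ K) identity 1ₚ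
              (represents-ι 1ₚ , represents-ι 0ₚ , represents-ι 0ₚ , represents-ι 1ₚ)
  ... | r₁₁ , r₁₂ , r₂₁ , r₂₂ =
    represents⇒≈Q r₁₁ (∼-trans (⊕-cong (⊗-cong n₁₁ ∼-refl) ∼-refl) (leftColumn D m₁₁ N₁₂)) ,
    represents⇒≈Q r₁₂ (∼-trans (⊕-cong ∼-refl (⊗-cong n₁₂ ∼-refl)) (rightColumn D m₁₂ N₁₁)) ,
    represents⇒≈Q r₂₁ (∼-trans (⊕-cong (⊗-cong n₂₁ ∼-refl) ∼-refl) (leftColumn D m₂₁ N₂₂)) ,
    represents⇒≈Q r₂₂ (∼-trans (⊕-cong ∼-refl (⊗-cong n₂₂ ∼-refl)) (rightColumn D m₂₂ N₂₁))
    where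
    D = den (product A)
    N₁₁ = M2.e₁₁ (num (product A))
    N₁₂ = M2.e₁₂ (num (product A))
    N₂₁ = M2.e₂₁ (num (product A))
    N₂₂ = M2.e₂₂ (num (product A))
    M = perturbedQ h (ε^ p) (error A)
    m₁₁ = M2.e₁₁ M
    m₁₂ = M2.e₁₂ M
    m₂₁ = M2.e₂₁ M
    m₂₂ = M2.e₂₂ M
    n₁₁ = proj₁ (num≈ A)
    n₁₂ = proj₁ (proj₂ (num≈ A))
    n₂₁ = proj₁ (proj₂ (proj₂ (num≈ A)))
    n₂₂ = proj₂ (proj₂ (proj₂ (num≈ A)))
    leftColumn : ∀ D m N → (D ⊗ m) ⊗ 1ₚ ⊕ N ⊗ 0ₚ ≃ (D ⊗ 1ₚ) ⊗ m
    leftColumn = solve 3 (λ D m N → (D :* m) :* :1 :+ N :* :0 := (D :* :1) :* m) ∼-refl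
    rightColumn : ∀ D m N → N ⊗ 0ₚ ⊕ (D ⊗ m) ⊗ 1ₚ ≃ (D ⊗ 1ₚ) ⊗ m
    rightColumn = solve 3 (λ D m N → N :* :0 :+ (D :* m) :* :1 := (D :* :1) :* m) ∼-refl

  perturbedQ-∈+O : ∀ h E → _∈_+O K (asMat2 (perturbedQ h (ε^ 1) E)) (Qpoly K h)
  perturbedQ-∈+O h (mk e₁ e₂ e₃ e₄) =
    (1ₚ ⊗ e₁ , difference h e₁) , (1ₚ ⊗ e₂ , difference 1ₚ e₂) ,
    (1ₚ ⊗ e₃ , difference 1ₚ e₃) , (1ₚ ⊗ e₄ , difference 0ₚ e₄)
    where
    difference : ∀ a e → (a ⊕ (eps ⊗ 1ₚ) ⊗ e) ⊕ ⊖ a ≃ eps ⊗ (1ₚ ⊗ e)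
    difference a e = solve 3 (λ a ε e → (a :+ (ε :* :1) :* e) :+ :- a := ε :* (:1 :* e)) ∼-refl a eps e

  perturbedQ-errDeg : ∀ {h p δ k E} → EpsFree K h → MatDeg≤ δ E → p + δ ≤ k →
    ErrDeg≤ K k (asMat2 (perturbedQ h (ε^ p) E))
  perturbedQ-errDeg {p = p} {δ} {E = mk _ _ _ _} fh (e₁ , e₂ , e₃ , e₄) p+δ≤k =
    entry fh e₁ , entry (const 1#) e₂ , entry (const 1#) e₃ , entry (const 0#) e₄
    where
    entry : ∀ {a e} → EpsFree K a → Deg≤ δ e → Deg≤ _ (a ⊕ ε^ p ⊗ e)
    entry fa de = deg-mono p+δ≤k (deg-⊕ (deg-mono z≤n (deg-free fa)) (deg-⊗ (deg-ε^ p) de))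

-- Bookkeeping: the number of primitives and the error degree (in units of
-- the precision exponent p) of the approximation built for depth d.
module Counting where

  open import Data.Nat using (zero; suc; _+_; z≤n; s≤s)
  import Data.Nat.Properties as ℕ
  open import Data.Nat.Tactic.RingSolver using (solve-∀)
  open import Relation.Binary.PropositionalEquality as ≡ using (_≡_)

  size : ℕ → ℕ
  size zero    = 1
  size (suc d) = 19 + 8 * size d

  size-positive : ∀ d → 1 ≤ size d
  size-positive zero    = s≤s z≤n
  size-positive (suc d) = s≤s z≤n

  errDeg : ℕ → ℕ
  errDeg zero    = 0
  errDeg (suc d) = 31 + 24 * errDeg d

  -- a sum node: two approximations and the middle factor Q(0)
  size-sum : ∀ s → s + (1 + s) ≤ 19 + 8 * s
  size-sum s = ≡.subst (s + (1 + s) ≤_) (≡.sym (split s)) (ℕ.m≤m+n _ (6 * s + 18))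
    where
    split : ∀ s → 19 + 8 * s ≡ (s + (1 + s)) + (6 * s + 18)
    split = solve-∀

  errDeg-sum : ∀ p e → 1 * p + 2 * (p * e) ≤ p * (31 + 24 * e)
  errDeg-sum p e = ≡.subst (1 * p + 2 * (p * e) ≤_) (≡.sym (split p e)) (ℕ.m≤m+n _ (30 * p + 22 * (p * e)))
    where
    split : ∀ p e → p * (31 + 24 * e) ≡ (1 * p + 2 * (p * e)) + (30 * p + 22 * (p * e))
    split = solve-∀

  -- a product node: the sum of two squares of sums
  size-product : ∀ s → let s′ = s + (1 + s) in
    (3 + (s′ + (1 + (s′ + 3)))) + (1 + (3 + (s′ + (1 + (s′ + 3))))) ≡ 19 + 8 * s
  size-product = solve-∀

  errDeg-product : ∀ p e → 1 * p + 2 * (9 * p + 2 * (1 * (3 * p) + 2 * (3 * p * e))) ≡ p * (31 + 24 * e)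
  errDeg-product = solve-∀

  size-bound : ∀ d → size d ≤ 45 * 9 ^ d
  size-bound zero    = s≤s z≤n
  size-bound (suc d) = begin
    19 + 8 * size d               ≤⟨ ℕ.+-mono-≤ (ℕ.≤-trans (ℕ.m≤m+n 19 26) (ℕ.*-monoʳ-≤ 45 (1≤9^ d)))
                                                (ℕ.*-monoʳ-≤ 8 (size-bound d)) ⟩
    45 * 9 ^ d + 8 * (45 * 9 ^ d) ≡⟨ regroup (9 ^ d) ⟩
    45 * (9 * 9 ^ d)              ∎
    where
    open ℕ.≤-Reasoning
    1≤9^ : ∀ d → 1 ≤ 9 ^ d
    1≤9^ d = ℕ.m^n>0 9 d
    regroup : ∀ x → 45 * x + 8 * (45 * x) ≡ 45 * (9 * x)
    regroup = solve-∀

  errDeg-bound : ∀ d → errDeg d + 2 ≤ 2 * 25 ^ d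
  errDeg-bound zero    = ℕ.≤-refl
  errDeg-bound (suc d) = begin
    (31 + 24 * errDeg d) + 2 ≤⟨ ℕ.m≤m+n _ 15 ⟩
    (31 + 24 * errDeg d) + 2 + 15 ≡⟨ regroup (errDeg d) ⟩
    24 * (errDeg d + 2)       ≤⟨ ℕ.*-monoʳ-≤ 24 (errDeg-bound d) ⟩
    24 * (2 * 25 ^ d)         ≤⟨ ℕ.*-monoˡ-≤ (2 * 25 ^ d) (ℕ.n≤1+n 24) ⟩
    25 * (2 * 25 ^ d)         ≡⟨ swap (25 ^ d) ⟩
    2 * (25 * 25 ^ d)         ∎
    where
    open ℕ.≤-Reasoning
    regroup : ∀ e → (31 + 24 * e) + 2 + 15 ≡ 24 * (e + 2)
    regroup = solve-∀
    swap : ∀ x → 25 * (2 * x) ≡ 2 * (25 * x)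
    swap = solve-∀

  finalErrDeg-bound : ∀ d → 1 + 1 * errDeg d ≤ 12 * 25 ^ d
  finalErrDeg-bound d = begin
    1 + 1 * errDeg d ≡⟨ shape (errDeg d) ⟩
    errDeg d + 1     ≤⟨ ℕ.+-monoʳ-≤ (errDeg d) (ℕ.n≤1+n 1) ⟩
    errDeg d + 2     ≤⟨ errDeg-bound d ⟩
    2 * 25 ^ d       ≤⟨ ℕ.*-monoˡ-≤ (25 ^ d) {2} {12} (s≤s (s≤s z≤n)) ⟩
    12 * 25 ^ d      ∎
    where
    open ℕ.≤-Reasoning
    shape : ∀ e → 1 + 1 * e ≡ e + 1
    shape = solve-∀

-- The construction by induction on the formula.
module FormulaApproximation {c ℓ} (K : Field c ℓ) (char≢2 : CharNot2 K) where

  open import Data.Nat as ℕ using (suc; z≤n; s≤s)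
  import Data.Nat.Properties as ℕ
  open import Data.Product using (proj₁; proj₂)
  open import Relation.Binary.PropositionalEquality as ≡ using (_≡_)
  open Approximations K
  open Counting
  private module Fld = Field K
  open Fld using (1#) renaming (Carrier to 𝔽)

  ⟦_⟧ᶠ : Formula K → Pol
  ⟦_⟧ᶠ = ⟦_⟧F K

  ⟦⟧-epsFree : ∀ φ → EpsFree K ⟦ φ ⟧ᶠ
  ⟦⟧-epsFree (leafVar i)   = var i
  ⟦⟧-epsFree (leafConst a) = const a
  ⟦⟧-epsFree (plus φ ψ)    = ⟦⟧-epsFree φ ⊕ ⟦⟧-epsFree ψ
  ⟦⟧-epsFree (times φ ψ)   = ⟦⟧-epsFree φ ⊗ ⟦⟧-epsFree ψ

  half : 𝔽
  half = proj₁ (Fld.inverse (1# Fld.+ 1#) char≢2)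

  two·half : (1ₚ ⊕ 1ₚ) ⊗ const half ≃ 1ₚ
  two·half = ∼-trans (⊗-cong (const-+ 1# 1#) ∼-refl)
               (∼-trans (const-* _ _) (const-cong (proj₂ (Fld.inverse (1# Fld.+ 1#) char≢2))))

  quarter : 𝔽 → 𝔽
  quarter α = α Fld.* (half Fld.* half)

  polarization : ∀ α f g →
    const (quarter α) ⊗ ((f ⊕ g) ⊗ (f ⊕ g)) ⊕ const (Fld.- quarter α) ⊗ ((f ⊕ ⊖ g) ⊗ (f ⊕ ⊖ g))
      ≃ const α ⊗ (f ⊗ g)
  polarization α f g =
    ∼-trans (⊕-cong (⊗-cong αy² ∼-refl) (⊗-cong (∼-trans (∼-sym (const-- _)) (⊖-cong αy²)) ∼-refl))
    (∼-trans (fourfold (const α) (const half) f g)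
    (∼-trans (⊗-cong (⊗-cong ∼-refl (⊗-cong two·half two·half)) ∼-refl)
    (solve 2 (λ a fg → a :* (:1 :* :1) :* fg := a :* fg) ∼-refl (const α) (f ⊗ g))))
    where
    αy² : const (quarter α) ≃ const α ⊗ (const half ⊗ const half)
    αy² = ∼-sym (∼-trans (⊗-cong ∼-refl (const-* half half)) (const-* _ _))
    fourfold : ∀ A Y f g →
      A ⊗ (Y ⊗ Y) ⊗ ((f ⊕ g) ⊗ (f ⊕ g)) ⊕ ⊖ (A ⊗ (Y ⊗ Y)) ⊗ ((f ⊕ ⊖ g) ⊗ (f ⊕ ⊖ g))
        ≃ A ⊗ (((1ₚ ⊕ 1ₚ) ⊗ Y) ⊗ ((1ₚ ⊕ 1ₚ) ⊗ Y)) ⊗ (f ⊗ g)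
    fourfold = solve 4 (λ A Y f g →
      A :* (Y :* Y) :* ((f :+ g) :* (f :+ g)) :+ :- (A :* (Y :* Y)) :* ((f :+ :- g) :* (f :+ :- g))
        := A :* (((:1 :+ :1) :* Y) :* ((:1 :+ :1) :* Y)) :* (f :* g)) ∼-refl

  approximation-formula : ∀ d φ → depth K φ ℕ.≤ d → ∀ α p →
    Approximation (const α ⊗ ⟦ φ ⟧ᶠ) p (p * errDeg d) (size d)
  approximation-formula d (leafVar i) _ α p =
    approximation-weaken z≤n (size-positive d) (approximation-leaf p (varForm α i) _ (varForm-represents α i))
  approximation-formula d (leafConst a) _ α p =
    approximation-weaken z≤n (size-positive d) (approximation-leaf p (constForm αa) _ (constForm-represents αa))
    where αa = polyCoeff (const α ⊗ const a) (const α ⊗ const a)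
  approximation-formula (suc d) (plus φ ψ) (s≤s depth≤) α p =
    approximation-weaken (errDeg-sum p (errDeg d)) (size-sum (size d))
      (approximation-cong (∼-sym (distribˡ (const α) ⟦ φ ⟧ᶠ ⟦ ψ ⟧ᶠ))
        (approximation-sum (const α ⊗ ⟦⟧-epsFree φ) (const α ⊗ ⟦⟧-epsFree ψ)
          (approximation-formula d φ (ℕ.m⊔n≤o⇒m≤o _ _ depth≤) α p)
          (approximation-formula d ψ (ℕ.m⊔n≤o⇒n≤o _ _ depth≤) α p)))
  approximation-formula (suc d) (times φ ψ) (s≤s depth≤) α p =
    ≡.subst₂ (Approximation (const α ⊗ (f ⊗ g)) p) (errDeg-product p (errDeg d)) (size-product (size d))
      (approximation-cong (polarization α f g)
        (approximation-sum (const _ ⊗ (free⁺ ⊗ free⁺)) (const _ ⊗ (free⁻ ⊗ free⁻))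
          (approximation-square (quarter α) free⁺ ∼-refl sum⁺ negSum⁺)
          (approximation-square (Fld.- quarter α) free⁻ ∼-refl sum⁻ negSum⁻)))
    where
    f = ⟦ φ ⟧ᶠ
    g = ⟦ ψ ⟧ᶠ
    free⁺ = ⟦⟧-epsFree φ ⊕ ⟦⟧-epsFree ψ
    free⁻ = ⟦⟧-epsFree φ ⊕ ⊖ ⟦⟧-epsFree ψ
    -- ±φ and ±ψ at precision ε^{3p}, as needed by the squaring gadget
    q = 3 * p
    signed : ∀ χ → depth K χ ℕ.≤ d → ∀ β →
             Approximation (const β ⊗ ⟦ χ ⟧ᶠ) q (q * errDeg d) (size d)
    signed χ le β = approximation-formula d χ le β q
    pos : ∀ χ → depth K χ ℕ.≤ d → Approximation ⟦ χ ⟧ᶠ q (q * errDeg d) (size d)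
    pos χ le = approximation-cong (⊗-idˡ _) (signed χ le 1#)
    neg : ∀ χ → depth K χ ℕ.≤ d → Approximation (⊖ ⟦ χ ⟧ᶠ) q (q * errDeg d) (size d)
    neg χ le = approximation-cong (∼-trans (⊗-cong (∼-sym (const-- 1#)) ∼-refl)
                                           (solve 1 (λ x → :- :1 :* x := :- x) ∼-refl _))
                                  (signed χ le (Fld.- 1#))
    φ≤ = ℕ.m⊔n≤o⇒m≤o _ _ depth≤
    ψ≤ = ℕ.m⊔n≤o⇒n≤o _ _ depth≤
    sum⁺ = approximation-sum (⟦⟧-epsFree φ) (⟦⟧-epsFree ψ) (pos φ φ≤) (pos ψ ψ≤)
    negSum⁺ = approximation-cong (solve 2 (λ f g → :- f :+ :- g := :- (f :+ g)) ∼-refl f g)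
                (approximation-sum (⊖ ⟦⟧-epsFree φ) (⊖ ⟦⟧-epsFree ψ) (neg φ φ≤) (neg ψ ψ≤))
    sum⁻ = approximation-sum (⟦⟧-epsFree φ) (⊖ ⟦⟧-epsFree ψ) (pos φ φ≤) (neg ψ ψ≤)
    negSum⁻ = approximation-cong (solve 2 (λ f g → :- f :+ g := :- (f :+ :- g)) ∼-refl f g)
                (approximation-sum (⊖ ⟦⟧-epsFree φ) (⟦⟧-epsFree ψ) (neg φ φ≤) (pos ψ ψ≤))

proposition3p5 : ∀ {c ℓ} (K : Field c ℓ) → CharNot2 K →
    (d : ℕ) (φ : Formula K) → depth K φ ≡ d → (α : Field.Carrier K) →
    ∃ λ (ls : List (PALF K)) → ∃ λ (M : Mat2 K (Tm K)) →
      (length ls ≤ 45 * 9 ^ d)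
      × _≈M_ K (prodQ K (map (Qprim K) ls)) (embed K M)
      × _∈_+O K M (Qpoly K (const α ⊗ ⟦_⟧F K φ))
      × ErrDeg≤ K (12 * 25 ^ d) M
proposition3p5 K char≢2 d φ depth≡d α =
  prims (product A) , asMat2 (perturbedQ h (ε^ 1) (error A)) ,
  ≤-trans (length≤ A) (size-bound d) ,
  approximation-product A ,
  perturbedQ-∈+O h (error A) ,
  perturbedQ-errDeg (const α ⊗ ⟦⟧-epsFree φ) (error-deg A) (finalErrDeg-bound d)
  where
  open Approximations K
  open FormulaApproximation K char≢2
  open Counting
  h = const α ⊗ ⟦_⟧F K φ
  A = approximation-formula d φ (≤-reflexive depth≡d) α 1
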